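{- Let $\beta:\mathcal{G}\rightarrow BSet$ be the linear map sending (the class of) a finite simple graph $\Gamma$ to (the class of) its graphical building set $\mathcal{B}(\Gamma)$. Then $\beta$ is an injective morphism of combinatorial Hopf algebras $(\mathcal{G},\zeta_{\mathcal{G}})\rightarrow(BSet,\zeta)$, and $\Psi\circ\beta=\Psi_{\mathcal{G}}$.
   Context: A building set on a finite set $X$ is a collection $\mathcal{B}$ of nonempty subsets of $X$ such that (B1) if $S,S'\in\mathcal{B}$ and $S\cap S'\neq\emptyset$ then $S\cup S'\in\mathcal{B}$, and (B2) $\{i\}\in\mathcal{B}$ for all $i\in X$. Its rank is $|X|$. The restriction to $I\subset X$ is $\mathcal{B}|_I=\{S\in\mathcal{B}: S\subset I\}$; $\mathcal{B}$ is discrete if it consists only of singletons. Two building sets are equivalent if a bijection of ground sets carries one onto the other. $BSet$ is the vector space over a field $\mathbb{K}$ of characteristic $0$ with basis the equivalence classes of building sets, graded by rank, with product $\mathcal{B}_X\cdot\mathcal{B}_Y=\mathcal{B}_X\sqcup\mathcal{B}_Y$ (building set on $X\sqcup Y$) and coproduct $\Delta(\mathcal{B}_X)=\sum_{I\subset X}\mathcal{B}_X|_I\otimes\mathcal{B}_X|_{X\setminus I}$; it is a graded connected commutative cocommutative Hopf algebra. The character $\zeta$ on $BSet$ is $\zeta(\mathcal{B})=1$ if $\mathcal{B}$ is discrete and $0$ otherwise. For a composition $\alpha=(a_1,\dots,a_k)$ of $n=|X|$, $\zeta_\alpha(\mathcal{B}_X)$ is the number of ordered decompositions $X=J_1\sqcup\dots\sqcup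 J_k$ with $|J_i|=a_i$ and $\mathcal{B}_X|_{J_i}$ discrete for all $i$. $\mathcal{G}$ is the Hopf algebra (over $\mathbb{K}$) with basis the isomorphism classes of finite simple graphs, graded by number of vertices, product disjoint union, coproduct $\Delta(\Gamma)=\sum_{I\subset V}\Gamma|_I\otimes\Gamma|_{V\setminus I}$ (induced subgraphs), with character $\zeta_{\mathcal{G}}(\Gamma)=1$ if $\Gamma$ has no edges and $0$ otherwise. For a graph $\Gamma=(V,E)$, the graphical building set is $\mathcal{B}(\Gamma)=\{I\subset V: I\neq\emptyset,\ \Gamma|_I \text{ connected}\}$. A combinatorial Hopf algebra $(\mathcal{H},\zeta)$ is a graded connected Hopf algebra with a multiplicative linear functional $\zeta$; a morphism $(\mathcal{H}_1,\zeta_1)\to(\mathcal{H}_2,\zeta_2)$ is a graded Hopf algebra morphism $\phi$ with $\zeta_2\circ\phi=\zeta_1$. $QSym$ is the Hopf algebra of quasi-symmetric functions with monomial basis $M_\alpha$. $\Psi:BSet\to QSym$ is $\Psi(\mathcal{B})=\sum_{\alpha\models n}\zeta_\alpha(\mathcal{B})M_\alpha$ for $\mathcal{B}$ of rank $n$, and $\Psi_{\mathcal{G}}(\Gamma)=\sum_{\alpha\models n}(\zeta_{\mathcal{G}})_\alpha(\Gamma)M_\alpha$, where $(\zeta_{\mathcal{G}})_\alpha(\Gamma)$ is the number of ordered decompositions $V=J_1\sqcup\dots\sqcup J_k$ with $|J_i|=a_i$ and each $\Gamma|_{J_i}$ edgeless (Stanley's chromatic symmetric function). -}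

module Defs where

open import Level using (Level; _⊔_) renaming (suc to lsuc)
open import Data.Bool using (Bool; true; false; not; _∧_; _∨_; _xor_; if_then_else_)
open import Data.Nat using (ℕ; zero; suc)
import Data.Nat.Properties as ℕP
open import Data.Fin using (Fin; splitAt)
open import Data.Fin.Properties using (_≟_)
open import Data.Fin.Subset using (Subset; ∁; _∩_; _∪_; ∣_∣; ⁅_⁆)
open import Data.Vec using (Vec; []; _∷_; lookup; tabulate; take; drop; fromList)
   renaming (_++_ to _++ᵥ_)
open import Data.List using (List; []; _∷_; map; concatMap; allFin; filterᵇ; length; foldr)
open import Data.Bool.ListAction using (all; any)
open import Data.Maybe using (Maybe; just; nothing; is-just)
open import Data.Product using (_×_; _,_; ∃)
open import Data.Sum using (inj₁; inj₂)
open import Relation.Nullary using (¬_; does)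
open import Relation.Binary.PropositionalEquality using (_≡_)
open import Algebra.Bundles using (CommutativeRing)

natK : ∀ {c ℓ} (R : CommutativeRing c ℓ) → ℕ → CommutativeRing.Carrier R
natK R zero = CommutativeRing.0# R
natK R (suc n) = CommutativeRing._+_ R (CommutativeRing.1# R) (natK R n)

record Field (c ℓ : Level) : Set (lsuc (c ⊔ ℓ)) where
  field
    commutativeRing : CommutativeRing c ℓ
  open CommutativeRing commutativeRing public
  field
    1≉0     : ¬ (1# ≈ 0#)
    inverse : ∀ x → ¬ (x ≈ 0#) → ∃ λ y → x * y ≈ 1#
    char0   : ∀ n → ¬ (natK commutativeRing (suc n) ≈ 0#)

_==ᵇ_ : Bool → Bool → Bool
a ==ᵇ b = not (a xor b)

_⇒ᵇ_ : Bool → Bool → Bool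
a ⇒ᵇ b = not a ∨ b

_==F_ : ∀ {n} → Fin n → Fin n → Bool
i ==F j = does (i ≟ j)

_==M_ : ∀ {n} → Maybe (Fin n) → Maybe (Fin n) → Bool
just i  ==M just j  = i ==F j
nothing ==M nothing = true
_       ==M _       = false

_==ℕ_ : ℕ → ℕ → Bool
m ==ℕ n = does (m ℕP.≟ n)

_==L_ : List ℕ → List ℕ → Bool
[] ==L [] = true
(x ∷ xs) ==L (y ∷ ys) = (x ==ℕ y) ∧ (xs ==L ys)
_ ==L _ = false

allVecs : ∀ {A : Set} → List A → (n : ℕ) → List (Vec A n)
allVecs xs zero = [] ∷ []
allVecs xs (suc n) = concatMap (λ x → map (x ∷_) (allVecs xs n)) xs

allSubsets : (n : ℕ) → List (Subset n)
allSubsets = allVecs (true ∷ false ∷ [])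

allMaybeFin : (m : ℕ) → List (Maybe (Fin m))
allMaybeFin m = nothing ∷ map just (allFin m)

allPMaps : (n m : ℕ) → List (Vec (Maybe (Fin m)) n)
allPMaps n m = allVecs (allMaybeFin m) n

mem : ∀ {n} → Subset n → Fin n → Bool
mem S i = lookup S i

nonempty : ∀ {n} → Subset n → Bool
nonempty {n} S = any (mem S) (allFin n)

_⊆ᵇ_ : ∀ {n} → Subset n → Subset n → Bool
_⊆ᵇ_ {n} S T = all (λ i → mem S i ⇒ᵇ mem T i) (allFin n)

isBijOn : ∀ {n m} → Subset n → Subset m → Vec (Maybe (Fin m)) n → Bool
isBijOn {n} {m} V W f =
  all (λ i → mem V i ⇒ᵇ inW (lookup f i)) (allFin n)
  ∧ all (λ i → all (λ i' → (mem V i ∧ mem V i' ∧ not (i ==F i'))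
                            ⇒ᵇ not (lookup f i ==M lookup f i')) (allFin n)) (allFin n)
  ∧ all (λ j → mem W j ⇒ᵇ any (λ i → mem V i ∧ (lookup f i ==M just j)) (allFin n)) (allFin m)
  where
  inW : Maybe (Fin m) → Bool
  inW (just j) = mem W j
  inW nothing  = false

image : ∀ {n m} → Vec (Maybe (Fin m)) n → Subset n → Subset m
image {n} f S = tabulate λ j → any (λ i → mem S i ∧ (lookup f i ==M just j)) (allFin n)

record Species : Set₁ where
  field
    Obj      : Set
    size     : Obj → ℕ                         -- ambient Fin (size x)
    verts    : (x : Obj) → Subset (size x)      -- actual ground set
    restr    : (x : Obj) → Subset (size x) → Obj -- restriction to verts x ∩ I
    _⊎ₒ_     : Obj → Obj → Obj
    emptyObj : Obj
    isoᵇ     : Obj → Obj → Bool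
    discᵇ    : Obj → Bool

  deg : Obj → ℕ
  deg x = ∣ verts x ∣

-- Finite simple graphs.  A graph is (n, V, a) with vertex set V ⊆ Fin n;
-- {i,j} ⊆ V is an edge iff i ≠ j and (a i j or a j i).  Every finite simple
-- graph arises this way.

record Gr : Set where
  constructor gr
  field
    n   : ℕ
    V   : Subset n
    adj : Fin n → Fin n → Bool

edge : (Γ : Gr) → Fin (Gr.n Γ) → Fin (Gr.n Γ) → Bool
edge Γ i j = not (i ==F j) ∧ (Gr.adj Γ i j ∨ Gr.adj Γ j i)

edgeM : (Γ : Gr) → Maybe (Fin (Gr.n Γ)) → Maybe (Fin (Gr.n Γ)) → Bool
edgeM Γ (just i) (just j) = edge Γ i j
edgeM Γ _ _ = false

isoGr : Gr → Gr → Bool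
isoGr Γ Δ = any (λ f → isBijOn (Gr.V Γ) (Gr.V Δ) f ∧
    all (λ i → all (λ i' → (mem (Gr.V Γ) i ∧ mem (Gr.V Γ) i')
         ⇒ᵇ (edge Γ i i' ==ᵇ edgeM Δ (lookup f i) (lookup f i')))
       (allFin (Gr.n Γ))) (allFin (Gr.n Γ)))
  (allPMaps (Gr.n Γ) (Gr.n Δ))

restrGr : (Γ : Gr) → Subset (Gr.n Γ) → Gr
restrGr (gr n V a) I = gr n (V ∩ I) a

unionGr : Gr → Gr → Gr
unionGr (gr n V a) (gr m W b) = gr (n Data.Nat.+ m) (V ++ᵥ W) c
  where
  c : Fin (n Data.Nat.+ m) → Fin (n Data.Nat.+ m) → Bool
  c i j with splitAt n i | splitAt n j
  ... | inj₁ i' | inj₁ j' = a i' j'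
  ... | inj₂ i' | inj₂ j' = b i' j'
  ... | _ | _ = false

emptyGr : Gr
emptyGr = gr 0 [] (λ ())

edgelessᵇ : Gr → Bool
edgelessᵇ Γ = all (λ i → all (λ j → (mem (Gr.V Γ) i ∧ mem (Gr.V Γ) j) ⇒ᵇ not (edge Γ i j))
                  (allFin (Gr.n Γ))) (allFin (Gr.n Γ))

GraphSp : Species
GraphSp = record
  { Obj = Gr ; size = Gr.n ; verts = Gr.V ; restr = restrGr ; _⊎ₒ_ = unionGr
  ; emptyObj = emptyGr ; isoᵇ = isoGr ; discᵇ = edgelessᵇ }

-- Set systems.  (n, V, b) denotes the collection of subsets
-- { S ⊆ V : S ≠ ∅, b S = true }  on the ground set V ⊆ Fin n.

record SSys : Set where
  constructor ss
  field
    n   : ℕ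
    V   : Subset n
    bm  : Subset n → Bool

inSys : (B : SSys) → Subset (SSys.n B) → Bool
inSys B S = nonempty S ∧ (S ⊆ᵇ SSys.V B) ∧ SSys.bm B S

isoSS : SSys → SSys → Bool
isoSS B C = any (λ f → isBijOn (SSys.V B) (SSys.V C) f ∧
    all (λ S → (S ⊆ᵇ SSys.V B) ⇒ᵇ (inSys B S ==ᵇ inSys C (image f S)))
      (allSubsets (SSys.n B)))
  (allPMaps (SSys.n B) (SSys.n C))

restrSS : (B : SSys) → Subset (SSys.n B) → SSys
restrSS (ss n V b) I = ss n (V ∩ I) b

emptyV : ∀ {n} → Subset n → Bool
emptyV S = not (nonempty S)

unionSS : SSys → SSys → SSys
unionSS (ss n V b) (ss m W c) = ss (n Data.Nat.+ m) (V ++ᵥ W)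
  (λ S → (emptyV (drop n S) ∧ b (take n S)) ∨ (emptyV (take n S) ∧ c (drop n S)))

emptySS : SSys
emptySS = ss 0 [] (λ _ → false)

discreteᵇ : SSys → Bool
discreteᵇ B = all (λ S → inSys B S ⇒ᵇ (∣ S ∣ ==ℕ 1)) (allSubsets (SSys.n B))

SSysSp : Species
SSysSp = record
  { Obj = SSys ; size = SSys.n ; verts = SSys.V ; restr = restrSS ; _⊎ₒ_ = unionSS
  ; emptyObj = emptySS ; isoᵇ = isoSS ; discᵇ = discreteᵇ }

IsBuildingSet : SSys → Set
IsBuildingSet B =
  (∀ S S' → inSys B S ≡ true → inSys B S' ≡ true → nonempty (S ∩ S') ≡ true
          → inSys B (S ∪ S') ≡ true)
  × (∀ i → mem (SSys.V B) i ≡ true → inSys B ⁅ i ⁆ ≡ true)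

connectedᵇ : (Γ : Gr) → Subset (Gr.n Γ) → Bool
connectedᵇ Γ I = nonempty I ∧
  all (λ A → ((A ⊆ᵇ I) ∧ nonempty A ∧ not (I ⊆ᵇ A)) ⇒ᵇ
        any (λ i → any (λ j → mem A i ∧ mem I j ∧ not (mem A j) ∧ edge Γ i j)
             (allFin (Gr.n Γ))) (allFin (Gr.n Γ)))
    (allSubsets (Gr.n Γ))

graphicalBS : Gr → SSys
graphicalBS Γ = ss (Gr.n Γ) (Gr.V Γ) (connectedᵇ Γ)

-- Compositions of n (lists of positive integers summing to n).
-- Each composition of n+1 arises from exactly one composition of n,
-- by prepending 1 or by increasing the first part.

compositions : ℕ → List (List ℕ)
compositions zero = [] ∷ []
compositions (suc n) = concatMap step (compositions n)
  where
  step : List ℕ → List (List ℕ)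
  step [] = (1 ∷ []) ∷ []
  step (a ∷ c) = (1 ∷ a ∷ c) ∷ (suc a ∷ c) ∷ []

-- Formal linear combinations over a field, with equality "same total
-- coefficient on every isomorphism class".

module Lin {c ℓ} (K : Field c ℓ) where
  open Field K

  LC : Set → Set c
  LC X = List (Carrier × X)

  coeff : ∀ {X : Set} → (X → X → Bool) → LC X → X → Carrier
  coeff eq v b = foldr (λ { (a , x) r → (if eq x b then a else 0#) + r }) 0# v

  Eqv : ∀ {X : Set} → (X → X → Bool) → LC X → LC X → Set ℓ
  Eqv eq v w = ∀ b → coeff eq v b ≈ coeff eq w b

  pairEq : ∀ {X Y : Set} → (X → X → Bool) → (Y → Y → Bool) → (X × Y) → (X × Y) → Bool
  pairEq e f (x , y) (x' , y') = e x x' ∧ f y y'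

  scale : ∀ {X : Set} → Carrier → LC X → LC X
  scale a = map (λ { (b , x) → (a * b , x) })

  linExt : ∀ {X Y : Set} → (X → LC Y) → LC X → LC Y
  linExt f = concatMap (λ { (a , x) → scale a (f x) })

  linMap : ∀ {X Y : Set} → (X → Y) → LC X → LC Y
  linMap f = map (λ { (a , x) → (a , f x) })

  linFun : ∀ {X : Set} → (X → Carrier) → LC X → Carrier
  linFun f v = foldr (λ { (a , x) r → a * f x + r }) 0# v

  module Str (Sp : Species) where
    open Species Sp

    EqH : LC Obj → LC Obj → Set ℓ
    EqH = Eqv isoᵇ

    EqH⊗H : LC (Obj × Obj) → LC (Obj × Obj) → Set ℓ
    EqH⊗H = Eqv (pairEq isoᵇ isoᵇ)

    unitH : LC Obj
    unitH = (1# , emptyObj) ∷ []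

    mult : LC Obj → LC Obj → LC Obj
    mult v w = concatMap (λ { (a , x) → map (λ { (b , y) → (a * b , x ⊎ₒ y) }) w }) v

    Δbasis : Obj → LC (Obj × Obj)
    Δbasis x = map (λ I → (1# , (restr x I , restr x (∁ I))))
                   (filterᵇ (λ I → I ⊆ᵇ verts x) (allSubsets (size x)))

    Δ : LC Obj → LC (Obj × Obj)
    Δ = linExt Δbasis

    counit : LC Obj → Carrier
    counit = linFun (λ x → if deg x ==ℕ 0 then 1# else 0#)

    proj : ℕ → LC Obj → LC Obj
    proj k = filterᵇ (λ { (_ , x) → deg x ==ℕ k })

    ζ : LC Obj → Carrier
    ζ = linFun (λ x → if discᵇ x then 1# else 0#)

    -- ζ_α(x): number of ordered decompositions V = J_1 ⊔ ... ⊔ J_k with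
    -- |J_t| = a_t and x|_{J_t} discrete; encoded by maps g : Fin n ⇀ Fin k
    -- defined exactly on V.
    ζα : Obj → List ℕ → ℕ
    ζα x α = length (filterᵇ ok (allPMaps (size x) (length α)))
      where
      ok : Vec (Maybe (Fin (length α))) (size x) → Bool
      ok g = all (λ i → is-just (lookup g i) ==ᵇ mem (verts x) i) (allFin (size x))
           ∧ all (λ t → let J = tabulate (λ i → lookup g i ==M just t) in
                          (∣ J ∣ ==ℕ lookup (fromList α) t) ∧ discᵇ (restr x J))
                 (allFin (length α))

    -- Ψ(x) = Σ_{α ⊨ deg x} ζ_α(x) M_α  ∈ QSym (QSym elements: LC of compositions)
    Ψ : LC Obj → LC (List ℕ)
    Ψ = linExt (λ x → map (λ α → (natK commutativeRing (ζα x α) , α)) (compositions (deg x)))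

  EqQSym : LC (List ℕ) → LC (List ℕ) → Set ℓ
  EqQSym = Eqv _==L_

  module _ (Sp₁ Sp₂ : Species) (f : Species.Obj Sp₁ → Species.Obj Sp₂) where
    private
      module S₁ = Str Sp₁
      module S₂ = Str Sp₂

    φ : LC (Species.Obj Sp₁) → LC (Species.Obj Sp₂)
    φ = linMap f

    φ⊗φ : LC (Species.Obj Sp₁ × Species.Obj Sp₁) → LC (Species.Obj Sp₂ × Species.Obj Sp₂)
    φ⊗φ = linMap (λ { (x , y) → (f x , f y) })

    record IsCHAMorphism : Set (c ⊔ ℓ) where
      field
        well-defined   : ∀ v w → S₁.EqH v w → S₂.EqH (φ v) (φ w)
        graded         : ∀ k v → S₂.EqH (φ (S₁.proj k v)) (S₂.proj k (φ v))
        unit-pres      : S₂.EqH (φ S₁.unitH) S₂.unitH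
        mult-pres      : ∀ v w → S₂.EqH (φ (S₁.mult v w)) (S₂.mult (φ v) (φ w))
        comult-pres    : ∀ v → S₂.EqH⊗H (S₂.Δ (φ v)) (φ⊗φ (S₁.Δ v))
        counit-pres    : ∀ v → S₂.counit (φ v) ≈ S₁.counit v
        character-pres : ∀ v → S₂.ζ (φ v) ≈ S₁.ζ v

-- Connected sets contain the singletons and are closed under unions of intersecting sets, so
-- B(Γ) is a building set. In an edgeless graph they are exactly the singletons, while an edge
-- is exactly a connected pair; hence B(Γ) is discrete iff Γ is edgeless, which gives
-- ζ ∘ β = ζ_G and, since ζ_α only tests restrictions for discreteness, Ψ ∘ β = Ψ_G.
-- Connectivity is transported along any partial map embedding the induced graph. For a graph
-- isomorphism this makes it an isomorphism of building sets; conversely an isomorphism of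
-- building sets preserves connected pairs, i.e. edges. So B(Γ) ≅ B(Δ) exactly when Γ ≅ Δ,
-- which makes β well defined and injective on isomorphism classes. For the two injections
-- into a disjoint union it shows that a connected set of the union lies in one side and is
-- connected there, so β preserves products; restriction commutes with β, so it preserves
-- the coproduct.

module Submission where

open import Defs
open import Data.Bool using (Bool; true; false; not; _∧_; _∨_; T; T?; if_then_else_)
open import Data.Bool.Properties using (T-≡; T-∧; T-∨; T-not-≡; ∨-comm; ∧-zeroʳ)
open import Data.Bool.ListAction using (all; any; and)
open import Data.Empty using (⊥; ⊥-elim)
open import Data.Fin using (Fin; zero; _↑ˡ_; _↑ʳ_; splitAt) renaming (suc to fsuc)
open import Data.Fin.Properties
  using (_≟_; ¬∀⟶∃¬; any?; ↑ˡ-injective; ↑ʳ-injective; splitAt-↑ˡ; splitAt-↑ʳ; splitAt⁻¹-↑ˡ; splitAt⁻¹-↑ʳ)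
open import Data.Fin.Subset
  using (Subset; _∈_; _∉_; _⊆_; _∩_; _∪_; ⁅_⁆; ∣_∣; Nonempty; Empty) renaming (⊥ to ∅)
open import Data.Fin.Subset.Properties
  using ( _∈?_; _⊆?_; nonempty?; Empty-unique; ∉⊥; x∈p∩q⁺; x∈p∩q⁻; x∈p∪q⁺; x∈p∪q⁻
        ; x∈⁅x⁆; x∈⁅y⁆⇒x≡y; ∣⁅x⁆∣≡1; ⊆-antisym; p⊂q⇒∣p∣<∣q∣ )
open import Data.List using (List; []; _∷_; allFin; map; concatMap; length; filterᵇ)
open import Data.List.Properties
  using (map-∘; map-cong; map-concatMap; concatMap-map; concatMap-cong; filter-≐)
open import Data.List.Membership.Propositional using () renaming (_∈_ to _∈ₗ_)
open import Data.List.Membership.Propositional.Properties using (∈-allFin; ∈-map⁺; ∈-concatMap⁺)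
open import Data.List.Relation.Unary.All using (All; []; _∷_)
import Data.List.Relation.Unary.All as All
open import Data.List.Relation.Unary.All.Properties using (all⁺; all⁻; ¬Any⇒All¬)
import Data.List.Relation.Unary.All.Properties as All
import Data.List.Relation.Unary.Any as Any
open import Data.List.Relation.Unary.Any.Properties using (any⁺; any⁻)
open import Data.Maybe using (Maybe; just; nothing; maybe; _>>=_)
open import Data.Maybe.Properties using (just-injective; ≡-dec)
open import Data.Nat using (ℕ; suc; _+_; _<_)
import Data.Nat.Properties as ℕ
open import Data.Product using (_×_; _,_; ∃; ∃₂; proj₁; proj₂)
import Data.Product as Product
open import Data.Sum using (_⊎_; inj₁; inj₂; [_,_]′)
import Data.Sum as Sum
open import Data.Unit using (tt)
open import Data.Vec using (Vec; []; _∷_; lookup; tabulate; _++_; take; drop)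
open import Data.Vec.Properties
  using ([]=⇒lookup; lookup⇒[]=; lookup∘tabulate; lookup-++ˡ; lookup-++ʳ; take++drop≡id)
open import Function using (_∘_; _⇔_; mk⇔; Equivalence)
open import Relation.Binary.PropositionalEquality
  using (_≡_; _≢_; refl; sym; trans; cong; cong₂; subst; module ≡-Reasoning)
open ≡-Reasoning
open import Relation.Nullary using (¬_; Dec; yes; no; _because_; does; invert; contradiction)
open import Relation.Nullary.Decidable using (does-⇔; _×-dec_)

open Equivalence using (to; from)

T-injective : ∀ {a b} → T a ⇔ T b → a ≡ b
T-injective {false} {false} _ = refl
T-injective {false} {true}  a⇔b = ⊥-elim (from a⇔b tt)
T-injective {true}  {false} a⇔b = ⊥-elim (to a⇔b tt)
T-injective {true}  {true}  _ = refl

T-not : ∀ {a} → T (not a) ⇔ (¬ T a)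
T-not {false} = mk⇔ (λ _ ()) (λ _ → tt)
T-not {true}  = mk⇔ (λ ()) (λ ¬t → ¬t tt)

T-⇒ᵇ : ∀ {a b} → T (a ⇒ᵇ b) ⇔ (T a → T b)
T-⇒ᵇ {false} = mk⇔ (λ _ ()) (λ _ → tt)
T-⇒ᵇ {true}  = mk⇔ (λ t _ → t) (λ f → f tt)

¬T-⇒ᵇ : ∀ {a b} → ¬ T (a ⇒ᵇ b) → T a × ¬ T b
¬T-⇒ᵇ {false} ¬t = ⊥-elim (¬t tt)
¬T-⇒ᵇ {true}  ¬t = tt , ¬t

T-∧-≡false : ∀ {a b} → a ∧ b ≡ false → ¬ T a ⊎ ¬ T b
T-∧-≡false {false} _  = inj₁ λ ()
T-∧-≡false {true}  eq = inj₂ (subst T eq)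

T-==ᵇ : ∀ {a b} → T (a ==ᵇ b) ⇔ a ≡ b
T-==ᵇ {false} {false} = mk⇔ (λ _ → refl) (λ _ → tt)
T-==ᵇ {false} {true}  = mk⇔ (λ ()) (λ ())
T-==ᵇ {true}  {false} = mk⇔ (λ ()) (λ ())
T-==ᵇ {true}  {true}  = mk⇔ (λ _ → refl) (λ _ → tt)

T-does : ∀ {A : Set} (a? : Dec A) → T (does a?) ⇔ A
T-does (true  because [a])  = mk⇔ (λ _ → invert [a]) (λ _ → tt)
T-does (false because [¬a]) = mk⇔ (λ ()) (invert [¬a])

T-==F : ∀ {n} {i j : Fin n} → T (i ==F j) ⇔ i ≡ j
T-==F {i = i} {j} = T-does (i ≟ j)

T-==M : ∀ {n} {a b : Maybe (Fin n)} → T (a ==M b) ⇔ a ≡ b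
T-==M {a = just i}  {just j}  = mk⇔ (cong just ∘ to T-==F) λ { refl → from (T-==F {i = i}) refl }
T-==M {a = just i}  {nothing} = mk⇔ (λ ()) (λ ())
T-==M {a = nothing} {just j}  = mk⇔ (λ ()) (λ ())
T-==M {a = nothing} {nothing} = mk⇔ (λ _ → refl) (λ _ → tt)

T-==ℕ : ∀ {m n} → T (m ==ℕ n) ⇔ m ≡ n
T-==ℕ {m} {n} = T-does (m ℕ.≟ n)

T-mem : ∀ {n} {S : Subset n} {i} → T (mem S i) ⇔ i ∈ S
T-mem {S = S} {i} = mk⇔ (lookup⇒[]= i S ∘ to T-≡) (from T-≡ ∘ []=⇒lookup)

module _ {A : Set} (p : A → Bool) {xs : List A} where

  T-all : (∀ x → x ∈ₗ xs) → T (all p xs) ⇔ (∀ x → T (p x))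
  T-all complete =
    mk⇔ (λ t x → All.lookup (all⁺ p xs t) (complete x)) (λ h → all⁻ p {xs} (All.tabulate (λ {x} _ → h x)))

  T-any : (∀ x → x ∈ₗ xs) → T (any p xs) ⇔ ∃ (T ∘ p)
  T-any complete =
    mk⇔ (λ t → Any.satisfied (any⁻ p xs t)) (λ (x , px) → any⁺ p (Any.map (λ { refl → px }) (complete x)))

∈-allVecs : ∀ {A : Set} {xs : List A} {n} (v : Vec A n) → (∀ i → lookup v i ∈ₗ xs) → v ∈ₗ allVecs xs n
∈-allVecs []      _  = Any.here refl
∈-allVecs {xs = xs} {suc n} (x ∷ v) ∈xs =
  ∈-concatMap⁺ (λ y → map (y ∷_) (allVecs xs n))
    (Any.map (λ { refl → ∈-map⁺ (x ∷_) (∈-allVecs v (∈xs ∘ fsuc)) }) (∈xs zero))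

∈-allSubsets : ∀ {n} (S : Subset n) → S ∈ₗ allSubsets n
∈-allSubsets S = ∈-allVecs S (∈-bools ∘ lookup S)
  where
  ∈-bools : ∀ b → b ∈ₗ (true ∷ false ∷ [])
  ∈-bools true  = Any.here refl
  ∈-bools false = Any.there (Any.here refl)

∈-allPMaps : ∀ {n m} (f : Vec (Maybe (Fin m)) n) → f ∈ₗ allPMaps n m
∈-allPMaps {m = m} f = ∈-allVecs f (∈-allMaybeFin ∘ lookup f)
  where
  ∈-allMaybeFin : ∀ a → a ∈ₗ allMaybeFin m
  ∈-allMaybeFin nothing  = Any.here refl
  ∈-allMaybeFin (just j) = Any.there (∈-map⁺ just (∈-allFin j))

T-allFin : ∀ {n} (p : Fin n → Bool) → T (all p (allFin n)) ⇔ (∀ i → T (p i))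
T-allFin p = T-all p ∈-allFin

T-anyFin : ∀ {n} (p : Fin n → Bool) → T (any p (allFin n)) ⇔ ∃ (T ∘ p)
T-anyFin p = T-any p ∈-allFin

T-allSubsets : ∀ {n} (p : Subset n → Bool) → T (all p (allSubsets n)) ⇔ (∀ S → T (p S))
T-allSubsets p = T-all p ∈-allSubsets

map-∘-cong : ∀ {a b b' c} {A : Set a} {B : Set b} {B' : Set b'} {C : Set c}
               {f : B → C} {g : A → B} {f' : B' → C} {g' : A → B'}
           → (∀ x → f (g x) ≡ f' (g' x)) → ∀ xs → map f (map g xs) ≡ map f' (map g' xs)
map-∘-cong same xs = trans (sym (map-∘ xs)) (trans (map-cong same xs) (map-∘ xs))

filterᵇ-cong : ∀ {A : Set} (p q : A → Bool) → (∀ x → p x ≡ q x) → ∀ xs → filterᵇ p xs ≡ filterᵇ q xs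
filterᵇ-cong p q p≗q xs = filter-≐ (T? ∘ p) (T? ∘ q) (subst T (p≗q _) , subst T (sym (p≗q _))) xs

T-nonempty : ∀ {n} {S : Subset n} → T (nonempty S) ⇔ Nonempty S
T-nonempty {S = S} = mk⇔ (λ t → let (i , i∈S) = to (T-anyFin (mem S)) t in i , to T-mem i∈S)
                         (λ (i , i∈S) → from (T-anyFin (mem S)) (i , from T-mem i∈S))

T-⊆ᵇ : ∀ {n} (S U : Subset n) → T (S ⊆ᵇ U) ⇔ S ⊆ U
T-⊆ᵇ S U =
  mk⇔ (λ t {i} i∈S → to T-mem (to T-⇒ᵇ (to (T-allFin incl) t i) (from T-mem i∈S)))
      (λ S⊆U → from (T-allFin incl) λ i → from T-⇒ᵇ (from T-mem ∘ S⊆U ∘ to T-mem))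
  where
  incl = λ i → mem S i ⇒ᵇ mem U i

∈-pairˡ : ∀ {n} (i j : Fin n) → i ∈ ⁅ i ⁆ ∪ ⁅ j ⁆
∈-pairˡ i j = x∈p∪q⁺ (inj₁ (x∈⁅x⁆ i))

∈-pairʳ : ∀ {n} (i j : Fin n) → j ∈ ⁅ i ⁆ ∪ ⁅ j ⁆
∈-pairʳ i j = x∈p∪q⁺ {p = ⁅ i ⁆} (inj₂ (x∈⁅x⁆ j))

∈-pair⁻ : ∀ {n} {i j k : Fin n} → k ∈ ⁅ i ⁆ ∪ ⁅ j ⁆ → k ≡ i ⊎ k ≡ j
∈-pair⁻ {i = i} {j} k∈ with x∈p∪q⁻ ⁅ i ⁆ ⁅ j ⁆ k∈
... | inj₁ k∈⁅i⁆ = inj₁ (x∈⁅y⁆⇒x≡y i k∈⁅i⁆)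
... | inj₂ k∈⁅j⁆ = inj₂ (x∈⁅y⁆⇒x≡y j k∈⁅j⁆)

pair⊆ : ∀ {n} {i j : Fin n} {A} → i ∈ A → j ∈ A → ⁅ i ⁆ ∪ ⁅ j ⁆ ⊆ A
pair⊆ i∈A j∈A k∈ with ∈-pair⁻ k∈
... | inj₁ refl = i∈A
... | inj₂ refl = j∈A

1<∣pair∣ : ∀ {n} {i j : Fin n} → i ≢ j → 1 < ∣ ⁅ i ⁆ ∪ ⁅ j ⁆ ∣
1<∣pair∣ {i = i} {j} i≢j = subst (_< ∣ ⁅ i ⁆ ∪ ⁅ j ⁆ ∣) (∣⁅x⁆∣≡1 i)
  (p⊂q⇒∣p∣<∣q∣ ((x∈p∪q⁺ ∘ inj₁) , j , ∈-pairʳ i j , i≢j ∘ sym ∘ x∈⁅y⁆⇒x≡y i))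

-- Connectivity

module _ (Γ : Gr) where
  private
    n = Gr.n Γ

  edge-sym : (i j : Fin n) → edge Γ i j ≡ edge Γ j i
  edge-sym i j = cong₂ (λ e a → not e ∧ a) (does-⇔ (mk⇔ sym sym) (i ≟ j) (j ≟ i))
                       (∨-comm (Gr.adj Γ i j) (Gr.adj Γ j i))

  edge-irrefl : (i : Fin n) → edge Γ i i ≡ false
  edge-irrefl i = cong (λ b → not b ∧ (Gr.adj Γ i i ∨ Gr.adj Γ i i)) (to T-≡ (from (T-==F {i = i}) refl))

  Crossing : Subset n → Subset n → Set
  Crossing A I = ∃₂ λ i j → i ∈ A × j ∈ I × j ∉ A × T (edge Γ i j)

  record Connected (I : Subset n) : Set where
    field
      inhabited : Nonempty I
      crossing  : ∀ {A} → A ⊆ I → Nonempty A → ¬ I ⊆ A → Crossing A I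

  open Connected

  module _ (I : Subset n) where
    private
      properᵇ : Subset n → Bool
      properᵇ A = (A ⊆ᵇ I) ∧ nonempty A ∧ not (I ⊆ᵇ A)
      crossingᵇ : Subset n → Bool
      crossingᵇ A = any (λ i → any (λ j → mem A i ∧ mem I j ∧ not (mem A j) ∧ edge Γ i j)
                         (allFin n)) (allFin n)

    T-properᵇ : ∀ A → T (properᵇ A) ⇔ (A ⊆ I × Nonempty A × ¬ I ⊆ A)
    T-properᵇ A = mk⇔ fwd bwd
      where
      fwd : T (properᵇ A) → A ⊆ I × Nonempty A × ¬ I ⊆ A
      fwd t with to T-∧ t
      ... | A⊆I , rest with to T-∧ rest
      ... | neA , I⊈A = to (T-⊆ᵇ A I) A⊆I , to T-nonempty neA , to T-not I⊈A ∘ from (T-⊆ᵇ I A)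
      bwd : A ⊆ I × Nonempty A × ¬ I ⊆ A → T (properᵇ A)
      bwd (A⊆I , neA , I⊈A) =
        from T-∧ (from (T-⊆ᵇ A I) A⊆I , from T-∧ (from T-nonempty neA , from T-not (I⊈A ∘ to (T-⊆ᵇ I A))))

    T-crossingᵇ : ∀ A → T (crossingᵇ A) ⇔ Crossing A I
    T-crossingᵇ A = mk⇔
      (λ t → let (i , t′) = to (T-anyFin _) t ; (j , c) = to (T-anyFin _) t′
                 (i∈A , c₁) = to T-∧ c ; (j∈I , c₂) = to T-∧ c₁ ; (j∉A , e) = to T-∧ c₂
             in i , j , to T-mem i∈A , to T-mem j∈I , to T-not j∉A ∘ from T-mem , e)
      (λ (i , j , i∈A , j∈I , j∉A , e) → from (T-anyFin _) (i , from (T-anyFin _) (j ,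
         from T-∧ (from T-mem i∈A , from T-∧ (from T-mem j∈I ,
           from T-∧ (from T-not (j∉A ∘ to T-mem) , e))))))

    T-connectedᵇ : T (connectedᵇ Γ I) ⇔ Connected I
    T-connectedᵇ = mk⇔ fwd bwd
      where
      condition : Subset n → Bool
      condition A = properᵇ A ⇒ᵇ crossingᵇ A
      fwd : T (connectedᵇ Γ I) → Connected I
      fwd t = record
        { inhabited = to T-nonempty (proj₁ (to T-∧ t))
        ; crossing  = λ {A} A⊆I neA I⊈A → to (T-crossingᵇ A)
            (to T-⇒ᵇ (to (T-allSubsets condition) (proj₂ (to T-∧ t)) A)
                     (from (T-properᵇ A) (A⊆I , neA , I⊈A)))
        }
      bwd : Connected I → T (connectedᵇ Γ I)
      bwd c = from T-∧ (from T-nonempty (inhabited c) , from (T-allSubsets condition) λ A →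
        from T-⇒ᵇ λ p → let (A⊆I , neA , I⊈A) = to (T-properᵇ A) p
                        in from (T-crossingᵇ A) (crossing c A⊆I neA I⊈A))

  singleton-connected : ∀ i → Connected ⁅ i ⁆
  singleton-connected i = record
    { inhabited = i , x∈⁅x⁆ i
    ; crossing  = λ { {A} A⊆⁅i⁆ (a , a∈A) ⁅i⁆⊈A → ⊥-elim (⁅i⁆⊈A (⁅i⁆⊆ A⊆⁅i⁆ a∈A)) }
    }
    where
    ⁅i⁆⊆ : ∀ {A a} → A ⊆ ⁅ i ⁆ → a ∈ A → ⁅ i ⁆ ⊆ A
    ⁅i⁆⊆ A⊆⁅i⁆ a∈A k∈⁅i⁆
      rewrite x∈⁅y⁆⇒x≡y i k∈⁅i⁆ | sym (x∈⁅y⁆⇒x≡y i (A⊆⁅i⁆ a∈A)) = a∈A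

  crossing-via : ∀ {S U A} → S ⊆ U → Connected S → Nonempty (A ∩ S) → ¬ S ⊆ A → Crossing A U
  crossing-via {S} {U} {A} S⊆U c neA∩S S⊈A
    with crossing c (λ {x} → proj₂ ∘ x∈p∩q⁻ A S) neA∩S (λ S⊆A∩S → S⊈A (proj₁ ∘ x∈p∩q⁻ A S ∘ S⊆A∩S))
  ... | i , j , i∈A∩S , j∈S , j∉A∩S , e =
    i , j , proj₁ (x∈p∩q⁻ A S i∈A∩S) , S⊆U j∈S , (λ j∈A → j∉A∩S (x∈p∩q⁺ (j∈A , j∈S))) , e

  ∪-connected : ∀ {S S'} → Connected S → Connected S' → Nonempty (S ∩ S') → Connected (S ∪ S')
  ∪-connected {S} {S'} c c' (k , k∈S∩S') = record
    { inhabited = k , x∈p∪q⁺ (inj₁ k∈S)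
    ; crossing  = cross
    }
    where
    k∈S  = proj₁ (x∈p∩q⁻ S S' k∈S∩S')
    k∈S' = proj₂ (x∈p∩q⁻ S S' k∈S∩S')
    S⊆S∪S' : S ⊆ S ∪ S'
    S⊆S∪S' = x∈p∪q⁺ ∘ inj₁
    S'⊆S∪S' : S' ⊆ S ∪ S'
    S'⊆S∪S' = x∈p∪q⁺ ∘ inj₂
    cross : ∀ {A} → A ⊆ S ∪ S' → Nonempty A → ¬ (S ∪ S') ⊆ A → Crossing A (S ∪ S')
    cross {A} A⊆ (a , a∈A) ⊈A with k ∈? A
    ... | yes k∈A with S ⊆? A
    ...   | no S⊈A = crossing-via S⊆S∪S' c (k , x∈p∩q⁺ (k∈A , k∈S)) S⊈A
    ...   | yes S⊆A = crossing-via S'⊆S∪S' c' (k , x∈p∩q⁺ (k∈A , k∈S'))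
                        (λ S'⊆A → ⊈A λ x∈ → [ S⊆A , S'⊆A ]′ (x∈p∪q⁻ S S' x∈))
    cross {A} A⊆ (a , a∈A) ⊈A | no k∉A with x∈p∪q⁻ S S' (A⊆ a∈A)
    ... | inj₁ a∈S  = crossing-via S⊆S∪S' c (a , x∈p∩q⁺ (a∈A , a∈S)) (λ S⊆A → k∉A (S⊆A k∈S))
    ... | inj₂ a∈S' = crossing-via S'⊆S∪S' c' (a , x∈p∩q⁺ (a∈A , a∈S')) (λ S'⊆A → k∉A (S'⊆A k∈S'))

  edge⇒pair-connected : ∀ {i j} → T (edge Γ i j) → Connected (⁅ i ⁆ ∪ ⁅ j ⁆)
  edge⇒pair-connected {i} {j} e = record
    { inhabited = i , ∈-pairˡ i j
    ; crossing  = cross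
    }
    where
    cross : ∀ {A} → A ⊆ ⁅ i ⁆ ∪ ⁅ j ⁆ → Nonempty A → ¬ (⁅ i ⁆ ∪ ⁅ j ⁆) ⊆ A → Crossing A (⁅ i ⁆ ∪ ⁅ j ⁆)
    cross A⊆ (a , a∈A) ⊈A with ∈-pair⁻ (A⊆ a∈A)
    ... | inj₁ refl = i , j , a∈A , ∈-pairʳ i j , (λ j∈A → ⊈A (pair⊆ a∈A j∈A)) , e
    ... | inj₂ refl = j , i , a∈A , ∈-pairˡ i j , (λ i∈A → ⊈A (pair⊆ i∈A a∈A)) , subst T (edge-sym i j) e

  pair-connected⇒edge : ∀ {i j} → i ≢ j → Connected (⁅ i ⁆ ∪ ⁅ j ⁆) → T (edge Γ i j)
  pair-connected⇒edge {i} {j} i≢j c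
    with crossing c (x∈p∪q⁺ ∘ inj₁) (i , x∈⁅x⁆ i)
                    (λ pair⊆⁅i⁆ → i≢j (sym (x∈⁅y⁆⇒x≡y i (pair⊆⁅i⁆ (∈-pairʳ i j)))))
  ... | a , b , a∈⁅i⁆ , b∈pair , b∉⁅i⁆ , e with x∈⁅y⁆⇒x≡y i a∈⁅i⁆ | ∈-pair⁻ b∈pair
  ...   | refl | inj₁ refl = contradiction (x∈⁅x⁆ a) b∉⁅i⁆
  ...   | refl | inj₂ refl = e

-- The graphical building set

T-discreteᵇ : ∀ B → T (discreteᵇ B) ⇔ (∀ S → T (inSys B S) → ∣ S ∣ ≡ 1)
T-discreteᵇ B = mk⇔
  (λ t S inS → to T-==ℕ (to T-⇒ᵇ (to (T-allSubsets singletonᵇ) t S) inS))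
  (λ h → from (T-allSubsets singletonᵇ) λ S → from T-⇒ᵇ (from T-==ℕ ∘ h S))
  where
  singletonᵇ = λ S → inSys B S ⇒ᵇ (∣ S ∣ ==ℕ 1)

module _ (Γ : Gr) where
  private
    n = Gr.n Γ
    V = Gr.V Γ
    B = graphicalBS Γ

  open Connected

  T-inSys-graphicalBS : ∀ S → T (inSys B S) ⇔ (S ⊆ V × Connected Γ S)
  T-inSys-graphicalBS S = mk⇔ fwd bwd
    where
    fwd : T (inSys B S) → S ⊆ V × Connected Γ S
    fwd t with to T-∧ (proj₂ (to (T-∧ {nonempty S}) t))
    ... | S⊆V , c = to (T-⊆ᵇ S V) S⊆V , to (T-connectedᵇ Γ S) c
    bwd : S ⊆ V × Connected Γ S → T (inSys B S)
    bwd (S⊆V , c) = from T-∧ (from T-nonempty (inhabited c) ,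
                      from T-∧ (from (T-⊆ᵇ S V) S⊆V , from (T-connectedᵇ Γ S) c))

  graphicalBS-isBuildingSet : IsBuildingSet B
  graphicalBS-isBuildingSet = union-closed , singletons
    where
    union-closed : ∀ S S' → inSys B S ≡ true → inSys B S' ≡ true → nonempty (S ∩ S') ≡ true
                 → inSys B (S ∪ S') ≡ true
    union-closed S S' S∈B S'∈B S∩S'≠∅ =
      let (S⊆V , c)   = to (T-inSys-graphicalBS S) (from T-≡ S∈B)
          (S'⊆V , c') = to (T-inSys-graphicalBS S') (from T-≡ S'∈B)
      in to T-≡ (from (T-inSys-graphicalBS (S ∪ S'))
           ( (λ x∈ → [ S⊆V , S'⊆V ]′ (x∈p∪q⁻ S S' x∈))
           , ∪-connected Γ c c' (to T-nonempty (from T-≡ S∩S'≠∅))))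
    singletons : ∀ i → mem V i ≡ true → inSys B ⁅ i ⁆ ≡ true
    singletons i i∈V = to T-≡ (from (T-inSys-graphicalBS ⁅ i ⁆)
      ( (λ k∈⁅i⁆ → subst (_∈ V) (sym (x∈⁅y⁆⇒x≡y i k∈⁅i⁆)) (to T-mem (from T-≡ i∈V)))
      , singleton-connected Γ i))

  Edgeless : Set
  Edgeless = ∀ {i j} → i ∈ V → j ∈ V → ¬ T (edge Γ i j)

  T-edgelessᵇ : T (edgelessᵇ Γ) ⇔ Edgeless
  T-edgelessᵇ = mk⇔ fwd bwd
    where
    nonadjacentᵇ : Fin n → Fin n → Bool
    nonadjacentᵇ i j = (mem V i ∧ mem V j) ⇒ᵇ not (edge Γ i j)
    fwd : T (edgelessᵇ Γ) → Edgeless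
    fwd t {i} {j} i∈V j∈V =
      to T-not (to T-⇒ᵇ (to (T-allFin (nonadjacentᵇ i)) (to (T-allFin _) t i) j)
                        (from T-∧ (from T-mem i∈V , from T-mem j∈V)))
    bwd : Edgeless → T (edgelessᵇ Γ)
    bwd h = from (T-allFin _) λ i → from (T-allFin (nonadjacentᵇ i)) λ j → from T-⇒ᵇ λ ij →
      let (i∈V , j∈V) = to T-∧ ij in from T-not (h (to T-mem i∈V) (to T-mem j∈V))

  connected-edgeless : Edgeless → ∀ {S i} → S ⊆ V → Connected Γ S → i ∈ S → S ≡ ⁅ i ⁆
  connected-edgeless edgeless {S} {i} S⊆V c i∈S =
    ⊆-antisym S⊆⁅i⁆ ⁅i⁆⊆S
    where
    ⁅i⁆⊆S : ⁅ i ⁆ ⊆ S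
    ⁅i⁆⊆S k∈⁅i⁆ = subst (_∈ S) (sym (x∈⁅y⁆⇒x≡y i k∈⁅i⁆)) i∈S
    S⊆⁅i⁆ : S ⊆ ⁅ i ⁆
    S⊆⁅i⁆ {k} k∈S with k ≟ i
    ... | yes refl = x∈⁅x⁆ k
    ... | no k≢i with crossing c ⁅i⁆⊆S (i , x∈⁅x⁆ i)
                        (λ S⊆⁅i⁆ → k≢i (x∈⁅y⁆⇒x≡y i (S⊆⁅i⁆ k∈S)))
    ...   | a , b , a∈⁅i⁆ , b∈S , _ , e = ⊥-elim (edgeless (S⊆V (⁅i⁆⊆S a∈⁅i⁆)) (S⊆V b∈S) e)

  discreteᵇ-graphicalBS : discreteᵇ B ≡ edgelessᵇ Γ
  discreteᵇ-graphicalBS = T-injective (mk⇔ discrete⇒edgeless edgeless⇒discrete)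
    where
    discrete⇒edgeless : T (discreteᵇ B) → T (edgelessᵇ Γ)
    discrete⇒edgeless d = from T-edgelessᵇ λ {i} {j} i∈V j∈V e →
      let ∣pair∣≡1 = to (T-discreteᵇ B) d (⁅ i ⁆ ∪ ⁅ j ⁆)
                       (from (T-inSys-graphicalBS _) (pair⊆ i∈V j∈V , edge⇒pair-connected Γ e))
          i≢j : i ≢ j
          i≢j = λ { refl → subst T (edge-irrefl Γ i) e }
      in ℕ.<-irrefl refl (subst (1 <_) ∣pair∣≡1 (1<∣pair∣ i≢j))
    edgeless⇒discrete : T (edgelessᵇ Γ) → T (discreteᵇ B)
    edgeless⇒discrete t = from (T-discreteᵇ B) λ S inS →
      let (S⊆V , c) = to (T-inSys-graphicalBS S) inS ; (i , i∈S) = inhabited c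
      in trans (cong ∣_∣ (connected-edgeless (to T-edgelessᵇ t) S⊆V c i∈S)) (∣⁅x⁆∣≡1 i)

PMap : ℕ → ℕ → Set
PMap n m = Vec (Maybe (Fin m)) n

∈-tabulate : ∀ {n} {g : Fin n → Bool} {i} → i ∈ tabulate g ⇔ T (g i)
∈-tabulate {g = g} {i} =
  mk⇔ (subst T (lookup∘tabulate g i) ∘ from T-mem) (to T-mem ∘ subst T (sym (lookup∘tabulate g i)))

module _ {n m} (f : PMap n m) where

  ∈-image⁻ : ∀ {S j} → j ∈ image f S → ∃ λ i → i ∈ S × lookup f i ≡ just j
  ∈-image⁻ j∈ with to (T-anyFin _) (to ∈-tabulate j∈)
  ... | i , t with to T-∧ t
  ...   | i∈S , fi≡j = i , to T-mem i∈S , to T-==M fi≡j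

  ∈-image⁺ : ∀ {S i j} → i ∈ S → lookup f i ≡ just j → j ∈ image f S
  ∈-image⁺ {i = i} i∈S fi≡j =
    from ∈-tabulate (from (T-anyFin _) (i , from T-∧ (from T-mem i∈S , from T-==M fi≡j)))

  image-mono : ∀ {A S} → A ⊆ S → image f A ⊆ image f S
  image-mono A⊆S j∈ with ∈-image⁻ j∈
  ... | i , i∈A , fi≡j = ∈-image⁺ (A⊆S i∈A) fi≡j

  preimage : Subset m → Subset n
  preimage A = tabulate (λ i → maybe (mem A) false (lookup f i))

  ∈-preimage : ∀ {A i} → i ∈ preimage A ⇔ ∃ λ j → lookup f i ≡ just j × j ∈ A
  ∈-preimage {A} {i} = mk⇔ fwd bwd
    where
    fwd : i ∈ preimage A → ∃ λ j → lookup f i ≡ just j × j ∈ A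
    fwd i∈ with lookup f i | to ∈-tabulate i∈
    ... | just j | j∈A = j , refl , to T-mem j∈A
    bwd : (∃ λ j → lookup f i ≡ just j × j ∈ A) → i ∈ preimage A
    bwd (j , fi≡j , j∈A) = from ∈-tabulate (subst (T ∘ maybe (mem A) false) (sym fi≡j) (from T-mem j∈A))

-- Transport of connectivity along embeddings

record EmbeddingOn (Γ Δ : Gr) (f : PMap (Gr.n Γ) (Gr.n Δ)) (S : Subset (Gr.n Γ)) : Set where
  field
    defined   : ∀ {i} → i ∈ S → ∃ λ j → lookup f i ≡ just j
    injective : ∀ {i i'} → i ∈ S → i' ∈ S → lookup f i ≡ lookup f i' → i ≡ i'
    edge-pres : ∀ {i i' j j'} → i ∈ S → i' ∈ S → lookup f i ≡ just j → lookup f i' ≡ just j'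
              → edge Δ j j' ≡ edge Γ i i'

module _ {Γ Δ : Gr} {f : PMap (Gr.n Γ) (Gr.n Δ)} {S : Subset (Gr.n Γ)} (emb : EmbeddingOn Γ Δ f S) where
  open EmbeddingOn emb
  open Connected

  image-connected⁺ : Connected Γ S → Connected Δ (image f S)
  image-connected⁺ c = record { inhabited = inhabited′ ; crossing = cross }
    where
    inhabited′ : Nonempty (image f S)
    inhabited′ with inhabited c
    ... | i , i∈S with defined i∈S
    ...   | j , fi≡j = j , ∈-image⁺ f i∈S fi≡j
    cross : ∀ {A'} → A' ⊆ image f S → Nonempty A' → ¬ image f S ⊆ A' → Crossing Δ A' (image f S)
    cross {A'} A'⊆ (a' , a'∈A') img⊈A'
      with ∈-image⁻ f (A'⊆ a'∈A')
    ... | a , a∈S , fa≡a'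
      with crossing c (proj₁ ∘ x∈p∩q⁻ S (preimage f A'))
                      (a , x∈p∩q⁺ (a∈S , from (∈-preimage f) (a' , fa≡a' , a'∈A'))) S⊈A
      where
      S⊈A : ¬ S ⊆ S ∩ preimage f A'
      S⊈A S⊆A = img⊈A' img⊆A'
        where
        img⊆A' : image f S ⊆ A'
        img⊆A' k∈ with ∈-image⁻ f k∈
        ... | i , i∈S , fi≡k with to (∈-preimage f) (proj₂ (x∈p∩q⁻ S _ (S⊆A i∈S)))
        ...   | k' , fi≡k' , k'∈A' = subst (_∈ A') (just-injective (trans (sym fi≡k') fi≡k)) k'∈A'
    ... | i , j , i∈A , j∈S , j∉A , e with to (∈-preimage f) (proj₂ (x∈p∩q⁻ S _ i∈A)) | defined j∈S
    ...   | i' , fi≡i' , i'∈A' | j' , fj≡j' =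
      i' , j' , i'∈A' , ∈-image⁺ f j∈S fj≡j'
         , (λ j'∈A' → j∉A (x∈p∩q⁺ (j∈S , from (∈-preimage f) (j' , fj≡j' , j'∈A'))))
         , subst T (sym (edge-pres (proj₁ (x∈p∩q⁻ S _ i∈A)) j∈S fi≡i' fj≡j')) e

  image-connected⁻ : Connected Δ (image f S) → Connected Γ S
  image-connected⁻ c = record { inhabited = inhabited′ ; crossing = cross }
    where
    inhabited′ : Nonempty S
    inhabited′ with inhabited c
    ... | j , j∈ with ∈-image⁻ f j∈
    ...   | i , i∈S , _ = i , i∈S
    cross : ∀ {A} → A ⊆ S → Nonempty A → ¬ S ⊆ A → Crossing Γ A S
    cross {A} A⊆S (a , a∈A) S⊈A with defined (A⊆S a∈A)
    ... | a' , fa≡a' with crossing c (image-mono f A⊆S) (a' , ∈-image⁺ f a∈A fa≡a') img⊈A'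
      where
      img⊈A' : ¬ image f S ⊆ image f A
      img⊈A' img⊆ = S⊈A S⊆A
        where
        S⊆A : S ⊆ A
        S⊆A i∈S with defined i∈S
        ... | j , fi≡j with ∈-image⁻ f (img⊆ (∈-image⁺ f i∈S fi≡j))
        ...   | i' , i'∈A , fi'≡j = subst (_∈ A) (injective (A⊆S i'∈A) i∈S (trans fi'≡j (sym fi≡j))) i'∈A
    ... | k , l , k∈A' , l∈img , l∉A' , e with ∈-image⁻ f k∈A' | ∈-image⁻ f l∈img
    ...   | i , i∈A , fi≡k | j , j∈S , fj≡l =
      i , j , i∈A , j∈S , (λ j∈A → l∉A' (∈-image⁺ f j∈A fj≡l)) , subst T (edge-pres (A⊆S i∈A) j∈S fi≡k fj≡l) e

-- Isomorphisms

record BijOn {n m} (V : Subset n) (W : Subset m) (f : PMap n m) : Set where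
  field
    maps-to    : ∀ {i} → i ∈ V → ∃ λ j → lookup f i ≡ just j × j ∈ W
    injective  : ∀ {i i'} → i ∈ V → i' ∈ V → lookup f i ≡ lookup f i' → i ≡ i'
    surjective : ∀ {j} → j ∈ W → ∃ λ i → i ∈ V × lookup f i ≡ just j

  image⊆ : ∀ {S} → S ⊆ V → image f S ⊆ W
  image⊆ S⊆V j∈ with ∈-image⁻ f j∈
  ... | i , i∈S , fi≡j with maps-to (S⊆V i∈S)
  ...   | j' , fi≡j' , j'∈W = subst (_∈ W) (just-injective (trans (sym fi≡j') fi≡j)) j'∈W

module _ {n m} (V : Subset n) (W : Subset m) (f : PMap n m) where
  private
    injectiveᵇ : Fin n → Fin n → Bool
    injectiveᵇ i i' = (mem V i ∧ mem V i' ∧ not (i ==F i')) ⇒ᵇ not (lookup f i ==M lookup f i')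
    surjectiveᵇ : Fin m → Bool
    surjectiveᵇ j = mem W j ⇒ᵇ any (λ i → mem V i ∧ (lookup f i ==M just j)) (allFin n)
    injective-surjectiveᵇ : Bool
    injective-surjectiveᵇ = all (λ i → all (injectiveᵇ i) (allFin n)) (allFin n) ∧ all surjectiveᵇ (allFin m)

  isBijOn-sound : T (isBijOn V W f) → BijOn V W f
  isBijOn-sound t = record { maps-to = maps-to ; injective = injective ; surjective = surjective }
    where
    parts = to (T-∧ {all (λ i → mem V i ⇒ᵇ _) (allFin n)} {injective-surjectiveᵇ}) t
    maps-to : ∀ {i} → i ∈ V → ∃ λ j → lookup f i ≡ just j × j ∈ W
    maps-to {i} i∈V with lookup f i | to T-⇒ᵇ (to (T-allFin _) (proj₁ parts) i) (from T-mem i∈V)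
    ... | just j | j∈W = j , refl , to T-mem j∈W
    injective : ∀ {i i'} → i ∈ V → i' ∈ V → lookup f i ≡ lookup f i' → i ≡ i'
    injective {i} {i'} i∈V i'∈V fi≡fi' with i ≟ i'
    ... | yes i≡i' = i≡i'
    ... | no i≢i' = ⊥-elim (to T-not (to T-⇒ᵇ
            (to (T-allFin (injectiveᵇ i)) (to (T-allFin _) (proj₁ (to T-∧ (proj₂ parts))) i) i')
            (from T-∧ (from T-mem i∈V , from T-∧ (from T-mem i'∈V , from T-not (i≢i' ∘ to T-==F)))))
            (from T-==M fi≡fi'))
    surjective : ∀ {j} → j ∈ W → ∃ λ i → i ∈ V × lookup f i ≡ just j
    surjective {j} j∈W with to (T-anyFin _) (to T-⇒ᵇ
      (to (T-allFin surjectiveᵇ) (proj₂ (to T-∧ (proj₂ parts))) j) (from T-mem j∈W))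
    ... | i , s = i , to T-mem (proj₁ (to T-∧ s)) , to T-==M (proj₂ (to T-∧ s))

  -- The first conjunct of isBijOn is phrased through a function local to Defs, which cannot be
  -- named here; it is reached by refuting its failure at some i and abstracting over lookup f i.
  isBijOn-complete : BijOn V W f → T (isBijOn V W f)
  isBijOn-complete b with isBijOn V W f in eq
  ... | true  = tt
  ... | false with T-∧-≡false eq
  ...   | inj₂ ¬rest = ⊥-elim (¬rest (from T-∧ (injectiveᵗ , surjectiveᵗ)))
    where
    open BijOn b
    injectiveᵗ = from (T-allFin _) λ i → from (T-allFin (injectiveᵇ i)) λ i' → from T-⇒ᵇ λ p →
      let (i∈V , q) = to T-∧ p ; (i'∈V , i≢i') = to T-∧ q
      in from T-not λ fi≡fi' →
           to T-not i≢i' (from T-==F (injective (to T-mem i∈V) (to T-mem i'∈V) (to T-==M fi≡fi')))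
    surjectiveᵗ = from (T-allFin surjectiveᵇ) λ j → from T-⇒ᵇ λ j∈W →
      let (i , i∈V , fi≡j) = surjective (to T-mem j∈W)
      in from (T-anyFin _) (i , from T-∧ (from T-mem i∈V , from T-==M fi≡j))
  ...   | inj₁ ¬maps-to with ¬∀⟶∃¬ n _ (T? ∘ _) (¬maps-to ∘ from (T-allFin _))
  ...     | i , ¬maps-toᵢ with ¬T-⇒ᵇ ¬maps-toᵢ
  ...       | i∈V , ¬inW with lookup f i | BijOn.maps-to b (to T-mem i∈V)
  ...         | .(just j) | j , refl , j∈W = ¬inW (from T-mem j∈W)

  T-isBijOn : T (isBijOn V W f) ⇔ BijOn V W f
  T-isBijOn = mk⇔ isBijOn-sound isBijOn-complete

record IsoSS (B C : SSys) (f : PMap (SSys.n B) (SSys.n C)) : Set where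
  field
    bijOn      : BijOn (SSys.V B) (SSys.V C) f
    inSys-pres : ∀ {S} → S ⊆ SSys.V B → inSys B S ≡ inSys C (image f S)

record IsoGr (Γ Δ : Gr) (f : PMap (Gr.n Γ) (Gr.n Δ)) : Set where
  field
    bijOn     : BijOn (Gr.V Γ) (Gr.V Δ) f
    edge-pres : ∀ {i i'} → i ∈ Gr.V Γ → i' ∈ Gr.V Γ → edge Γ i i' ≡ edgeM Δ (lookup f i) (lookup f i')

T-isoSS : ∀ B C → T (isoSS B C) ⇔ ∃ (IsoSS B C)
T-isoSS (ss n V b) C = mk⇔ fwd bwd
  where
  B = ss n V b
  presᵇ : PMap n (SSys.n C) → Subset n → Bool
  presᵇ f S = (S ⊆ᵇ V) ⇒ᵇ (inSys B S ==ᵇ inSys C (image f S))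
  isoᵇ : PMap n (SSys.n C) → Bool
  isoᵇ f = isBijOn V (SSys.V C) f ∧ all (presᵇ f) (allSubsets n)
  fwd : T (isoSS B C) → ∃ (IsoSS B C)
  fwd t with to (T-any isoᵇ ∈-allPMaps) t
  ... | f , t′ with to T-∧ t′
  ...   | bij , pres = f , record
    { bijOn      = to (T-isBijOn V (SSys.V C) f) bij
    ; inSys-pres = λ {S} S⊆V → to T-==ᵇ (to T-⇒ᵇ (to (T-allSubsets (presᵇ f)) pres S) (from (T-⊆ᵇ S V) S⊆V))
    }
  bwd : ∃ (IsoSS B C) → T (isoSS B C)
  bwd (f , iso) = from (T-any isoᵇ ∈-allPMaps) (f , from T-∧
    ( from (T-isBijOn V (SSys.V C) f) (IsoSS.bijOn iso)
    , from (T-allSubsets (presᵇ f)) λ S → from T-⇒ᵇ λ S⊆V →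
        from T-==ᵇ (IsoSS.inSys-pres iso (to (T-⊆ᵇ S V) S⊆V))))

T-isoGr : ∀ Γ Δ → T (isoGr Γ Δ) ⇔ ∃ (IsoGr Γ Δ)
T-isoGr Γ Δ = mk⇔ fwd bwd
  where
  n = Gr.n Γ
  V = Gr.V Γ
  presᵇ : PMap n (Gr.n Δ) → Fin n → Fin n → Bool
  presᵇ f i i' = (mem V i ∧ mem V i') ⇒ᵇ (edge Γ i i' ==ᵇ edgeM Δ (lookup f i) (lookup f i'))
  isoᵇ : PMap n (Gr.n Δ) → Bool
  isoᵇ f = isBijOn V (Gr.V Δ) f ∧ all (λ i → all (presᵇ f i) (allFin n)) (allFin n)
  fwd : T (isoGr Γ Δ) → ∃ (IsoGr Γ Δ)
  fwd t with to (T-any isoᵇ ∈-allPMaps) t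
  ... | f , t′ with to T-∧ t′
  ...   | bij , pres = f , record
    { bijOn     = to (T-isBijOn V (Gr.V Δ) f) bij
    ; edge-pres = λ {i} {i'} i∈V i'∈V → to T-==ᵇ (to T-⇒ᵇ
        (to (T-allFin (presᵇ f i)) (to (T-allFin _) pres i) i') (from T-∧ (from T-mem i∈V , from T-mem i'∈V)))
    }
  bwd : ∃ (IsoGr Γ Δ) → T (isoGr Γ Δ)
  bwd (f , iso) = from (T-any isoᵇ ∈-allPMaps) (f , from T-∧
    ( from (T-isBijOn V (Gr.V Δ) f) (IsoGr.bijOn iso)
    , from (T-allFin _) λ i → from (T-allFin (presᵇ f i)) λ i' → from T-⇒ᵇ λ p →
        from T-==ᵇ (IsoGr.edge-pres iso (to T-mem (proj₁ (to T-∧ p))) (to T-mem (proj₂ (to T-∧ p))))))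

-- Graph isomorphisms versus isomorphisms of graphical building sets

inSys-graphicalBS-pair : ∀ Γ {i j} → i ≢ j → i ∈ Gr.V Γ → j ∈ Gr.V Γ
                       → inSys (graphicalBS Γ) (⁅ i ⁆ ∪ ⁅ j ⁆) ≡ edge Γ i j
inSys-graphicalBS-pair Γ i≢j i∈V j∈V = T-injective (mk⇔
  (pair-connected⇒edge Γ i≢j ∘ proj₂ ∘ to (T-inSys-graphicalBS Γ _))
  (λ e → from (T-inSys-graphicalBS Γ _) (pair⊆ i∈V j∈V , edge⇒pair-connected Γ e)))

image-pair : ∀ {n m} (f : PMap n m) {i i' j j'} → lookup f i ≡ just j → lookup f i' ≡ just j'
           → image f (⁅ i ⁆ ∪ ⁅ i' ⁆) ≡ ⁅ j ⁆ ∪ ⁅ j' ⁆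
image-pair f {i} {i'} {j} {j'} fi≡j fi'≡j' = ⊆-antisym img⊆ ⊆img
  where
  img⊆ : image f (⁅ i ⁆ ∪ ⁅ i' ⁆) ⊆ ⁅ j ⁆ ∪ ⁅ j' ⁆
  img⊆ k∈ with ∈-image⁻ f k∈
  ... | a , a∈ , fa≡k with ∈-pair⁻ {i = i} {i'} a∈
  ...   | inj₁ refl = subst (_∈ _) (just-injective (trans (sym fi≡j) fa≡k)) (∈-pairˡ j j')
  ...   | inj₂ refl = subst (_∈ _) (just-injective (trans (sym fi'≡j') fa≡k)) (∈-pairʳ j j')
  ⊆img : ⁅ j ⁆ ∪ ⁅ j' ⁆ ⊆ image f (⁅ i ⁆ ∪ ⁅ i' ⁆)
  ⊆img k∈ with ∈-pair⁻ {i = j} {j'} k∈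
  ... | inj₁ refl = ∈-image⁺ f (∈-pairˡ i i') fi≡j
  ... | inj₂ refl = ∈-image⁺ f (∈-pairʳ i i') fi'≡j'

module _ {Γ Δ : Gr} {f : PMap (Gr.n Γ) (Gr.n Δ)} where

  IsoGr⇒EmbeddingOn : IsoGr Γ Δ f → ∀ {S} → S ⊆ Gr.V Γ → EmbeddingOn Γ Δ f S
  IsoGr⇒EmbeddingOn iso S⊆V = record
    { defined   = λ i∈S → let (j , fi≡j , _) = maps-to (S⊆V i∈S) in j , fi≡j
    ; injective = λ i∈S i'∈S → injective (S⊆V i∈S) (S⊆V i'∈S)
    ; edge-pres = λ i∈S i'∈S fi≡j fi'≡j' →
        trans (cong₂ (edgeM Δ) (sym fi≡j) (sym fi'≡j')) (sym (edge-pres (S⊆V i∈S) (S⊆V i'∈S)))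
    }
    where
    open IsoGr iso
    open BijOn bijOn

  IsoGr⇒IsoSS : IsoGr Γ Δ f → IsoSS (graphicalBS Γ) (graphicalBS Δ) f
  IsoGr⇒IsoSS iso = record { bijOn = IsoGr.bijOn iso ; inSys-pres = inSys-pres }
    where
    inSys-pres : ∀ {S} → S ⊆ Gr.V Γ → inSys (graphicalBS Γ) S ≡ inSys (graphicalBS Δ) (image f S)
    inSys-pres {S} S⊆V = T-injective (mk⇔
      (λ t → from (T-inSys-graphicalBS Δ _)
        (BijOn.image⊆ (IsoGr.bijOn iso) S⊆V , image-connected⁺ emb (proj₂ (to (T-inSys-graphicalBS Γ S) t))))
      (λ t → from (T-inSys-graphicalBS Γ S)
        (S⊆V , image-connected⁻ emb (proj₂ (to (T-inSys-graphicalBS Δ _) t)))))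
      where
      emb = IsoGr⇒EmbeddingOn iso S⊆V

  -- Edges are recovered as the connected two-element members of the building set.
  IsoSS⇒IsoGr : IsoSS (graphicalBS Γ) (graphicalBS Δ) f → IsoGr Γ Δ f
  IsoSS⇒IsoGr iso = record { bijOn = bijOn ; edge-pres = edge-pres }
    where
    open IsoSS iso
    open BijOn bijOn
    edge-pres : ∀ {i i'} → i ∈ Gr.V Γ → i' ∈ Gr.V Γ → edge Γ i i' ≡ edgeM Δ (lookup f i) (lookup f i')
    edge-pres {i} {i'} i∈V i'∈V with maps-to i∈V | maps-to i'∈V
    ... | j , fi≡j , j∈W | j' , fi'≡j' , j'∈W =
      trans (edges-agree (i ≟ i')) (sym (cong₂ (edgeM Δ) fi≡j fi'≡j'))
      where
      edges-agree : Dec (i ≡ i') → edge Γ i i' ≡ edge Δ j j'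
      edges-agree (yes refl) rewrite just-injective (trans (sym fi≡j) fi'≡j') =
        trans (edge-irrefl Γ i) (sym (edge-irrefl Δ j'))
      edges-agree (no i≢i') = begin
        edge Γ i i'                                       ≡⟨ sym (inSys-graphicalBS-pair Γ i≢i' i∈V i'∈V) ⟩
        inSys (graphicalBS Γ) (⁅ i ⁆ ∪ ⁅ i' ⁆)             ≡⟨ inSys-pres (pair⊆ i∈V i'∈V) ⟩
        inSys (graphicalBS Δ) (image f (⁅ i ⁆ ∪ ⁅ i' ⁆))
          ≡⟨ cong (inSys (graphicalBS Δ)) (image-pair f fi≡j fi'≡j') ⟩
        inSys (graphicalBS Δ) (⁅ j ⁆ ∪ ⁅ j' ⁆)             ≡⟨ inSys-graphicalBS-pair Δ j≢j' j∈W j'∈W ⟩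
        edge Δ j j'                                       ∎
        where
        j≢j' : j ≢ j'
        j≢j' refl = i≢i' (injective i∈V i'∈V (trans fi≡j (sym fi'≡j')))

module _ {n m} {V : Subset n} {W : Subset m} {f : PMap n m} (bij : BijOn V W f) where
  open BijOn bij

  private
    find : (j : Fin m) → Dec (∃ λ i → i ∈ V × lookup f i ≡ just j)
    find j = any? λ i → i ∈? V ×-dec ≡-dec _≟_ (lookup f i) (just j)

    invertAt : Fin m → Maybe (Fin n)
    invertAt j with find j
    ... | yes (i , _) = just i
    ... | no _        = nothing

  inverse : PMap m n
  inverse = tabulate invertAt

  inverse-sound : ∀ {j i} → lookup inverse j ≡ just i → i ∈ V × lookup f i ≡ just j
  inverse-sound {j} eq with find j | trans (sym (lookup∘tabulate invertAt j)) eq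
  ... | yes (i , p) | refl = p

  inverse-defined : ∀ {j} → j ∈ W → ∃ λ i → lookup inverse j ≡ just i
  inverse-defined {j} j∈W with find j | lookup∘tabulate invertAt j
  ... | yes (i , _) | eq = i , eq
  ... | no ¬∃       | _  = ⊥-elim (¬∃ (surjective j∈W))

  inverse-bijOn : BijOn W V inverse
  inverse-bijOn = record
    { maps-to    = λ j∈W → let (i , gj≡i) = inverse-defined j∈W in i , gj≡i , proj₁ (inverse-sound gj≡i)
    ; injective  = injective′
    ; surjective = surjective′
    }
    where
    injective′ : ∀ {j j'} → j ∈ W → j' ∈ W → lookup inverse j ≡ lookup inverse j' → j ≡ j'
    injective′ j∈W _ gj≡gj' with inverse-defined j∈W
    ... | i , gj≡i = just-injective (trans (sym (proj₂ (inverse-sound gj≡i)))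
                                          (proj₂ (inverse-sound (trans (sym gj≡gj') gj≡i))))
    surjective′ : ∀ {i} → i ∈ V → ∃ λ j → j ∈ W × lookup inverse j ≡ just i
    surjective′ i∈V with maps-to i∈V
    ... | j , fi≡j , j∈W with inverse-defined j∈W
    ...   | i' , gj≡i' with inverse-sound gj≡i'
    ...     | i'∈V , fi'≡j = j , j∈W , trans gj≡i' (cong just (injective i'∈V i∈V (trans fi'≡j (sym fi≡j))))

  image-image-inverse : ∀ {U} → U ⊆ W → image f (image inverse U) ≡ U
  image-image-inverse {U} U⊆W = ⊆-antisym img⊆ ⊆img
    where
    img⊆ : image f (image inverse U) ⊆ U
    img⊆ k∈ with ∈-image⁻ f k∈
    ... | i , i∈ , fi≡k with ∈-image⁻ inverse i∈
    ...   | j , j∈U , gj≡i = subst (_∈ U) (just-injective (trans (sym (proj₂ (inverse-sound gj≡i))) fi≡k)) j∈U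
    ⊆img : U ⊆ image f (image inverse U)
    ⊆img j∈U with inverse-defined (U⊆W j∈U)
    ... | i , gj≡i = ∈-image⁺ f (∈-image⁺ inverse j∈U gj≡i) (proj₂ (inverse-sound gj≡i))

IsoSS-sym : ∀ {B C f} (iso : IsoSS B C f) → IsoSS C B (inverse (IsoSS.bijOn iso))
IsoSS-sym {B} {C} {f} iso = record { bijOn = inverse-bijOn bijOn ; inSys-pres = inSys-pres′ }
  where
  open IsoSS iso
  inSys-pres′ : ∀ {U} → U ⊆ SSys.V C → inSys C U ≡ inSys B (image (inverse bijOn) U)
  inSys-pres′ U⊆W = sym (trans (inSys-pres (BijOn.image⊆ (inverse-bijOn bijOn) U⊆W))
                               (cong (inSys C) (image-image-inverse bijOn U⊆W)))

_∘ₚ_ : ∀ {n m k} → PMap m k → PMap n m → PMap n k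
g ∘ₚ f = tabulate λ i → lookup f i >>= lookup g

module _ {n m k} (g : PMap m k) (f : PMap n m) where

  lookup-∘ₚ : ∀ {i j} → lookup f i ≡ just j → lookup (g ∘ₚ f) i ≡ lookup g j
  lookup-∘ₚ {i} fi≡j = trans (lookup∘tabulate _ i) (cong (_>>= lookup g) fi≡j)

  lookup-∘ₚ⁻ : ∀ {i l} → lookup (g ∘ₚ f) i ≡ just l → ∃ λ j → lookup f i ≡ just j × lookup g j ≡ just l
  lookup-∘ₚ⁻ {i} eq with lookup f i | trans (sym (lookup∘tabulate (λ i → lookup f i >>= lookup g) i)) eq
  ... | just j | gj≡l = j , refl , gj≡l

  image-∘ₚ : ∀ S → image (g ∘ₚ f) S ≡ image g (image f S)
  image-∘ₚ S = ⊆-antisym img⊆ ⊆img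
    where
    img⊆ : image (g ∘ₚ f) S ⊆ image g (image f S)
    img⊆ l∈ with ∈-image⁻ (g ∘ₚ f) {S} l∈
    ... | i , i∈S , hi≡l with lookup-∘ₚ⁻ hi≡l
    ...   | j , fi≡j , gj≡l = ∈-image⁺ g (∈-image⁺ f i∈S fi≡j) gj≡l
    ⊆img : image g (image f S) ⊆ image (g ∘ₚ f) S
    ⊆img l∈ with ∈-image⁻ g {image f S} l∈
    ... | j , j∈ , gj≡l with ∈-image⁻ f {S} j∈
    ...   | i , i∈S , fi≡j = ∈-image⁺ (g ∘ₚ f) i∈S (trans (lookup-∘ₚ fi≡j) gj≡l)

BijOn-∘ₚ : ∀ {n m k} {U : Subset n} {V : Subset m} {W : Subset k} {f g}
         → BijOn U V f → BijOn V W g → BijOn U W (g ∘ₚ f)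
BijOn-∘ₚ {U = U} {V} {W} {f} {g} bf bg =
  record { maps-to = maps-to′ ; injective = injective′ ; surjective = surjective′ }
  where
  module F = BijOn bf
  module G = BijOn bg
  maps-to′ : ∀ {i} → i ∈ U → ∃ λ l → lookup (g ∘ₚ f) i ≡ just l × l ∈ W
  maps-to′ i∈U with F.maps-to i∈U
  ... | j , fi≡j , j∈V with G.maps-to j∈V
  ...   | l , gj≡l , l∈W = l , trans (lookup-∘ₚ g f fi≡j) gj≡l , l∈W
  injective′ : ∀ {i i'} → i ∈ U → i' ∈ U → lookup (g ∘ₚ f) i ≡ lookup (g ∘ₚ f) i' → i ≡ i'
  injective′ i∈U i'∈U hi≡hi' with F.maps-to i∈U | F.maps-to i'∈U
  ... | j , fi≡j , j∈V | j' , fi'≡j' , j'∈V =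
    F.injective i∈U i'∈U (trans fi≡j (trans (cong just j≡j') (sym fi'≡j')))
    where
    j≡j' = G.injective j∈V j'∈V (trans (sym (lookup-∘ₚ g f fi≡j)) (trans hi≡hi' (lookup-∘ₚ g f fi'≡j')))
  surjective′ : ∀ {l} → l ∈ W → ∃ λ i → i ∈ U × lookup (g ∘ₚ f) i ≡ just l
  surjective′ l∈W with G.surjective l∈W
  ... | j , j∈V , gj≡l with F.surjective j∈V
  ...   | i , i∈U , fi≡j = i , i∈U , trans (lookup-∘ₚ g f fi≡j) gj≡l

IsoSS-trans : ∀ {B C D f g} → IsoSS B C f → IsoSS C D g → IsoSS B D (g ∘ₚ f)
IsoSS-trans {B} {C} {D} {f} {g} isoF isoG = record
  { bijOn      = BijOn-∘ₚ (IsoSS.bijOn isoF) (IsoSS.bijOn isoG)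
  ; inSys-pres = λ {S} S⊆V → begin
      inSys B S                      ≡⟨ IsoSS.inSys-pres isoF S⊆V ⟩
      inSys C (image f S)            ≡⟨ IsoSS.inSys-pres isoG (BijOn.image⊆ (IsoSS.bijOn isoF) S⊆V) ⟩
      inSys D (image g (image f S))  ≡⟨ cong (inSys D) (sym (image-∘ₚ g f S)) ⟩
      inSys D (image (g ∘ₚ f) S)     ∎
  }

isoSS-sym : ∀ B C → T (isoSS B C) → T (isoSS C B)
isoSS-sym B C t = from (T-isoSS C B) (_ , IsoSS-sym (proj₂ (to (T-isoSS B C) t)))

isoSS-trans : ∀ B C D → T (isoSS B C) → T (isoSS C D) → T (isoSS B D)
isoSS-trans B C D t t′ =
  from (T-isoSS B D) (_ , IsoSS-trans (proj₂ (to (T-isoSS B C) t)) (proj₂ (to (T-isoSS C D) t′)))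

isoSS-congˡ : ∀ {n V} {b b' : Subset n → Bool} C → (∀ S → inSys (ss n V b) S ≡ inSys (ss n V b') S)
            → isoSS (ss n V b) C ≡ isoSS (ss n V b') C
isoSS-congˡ {n} {V} {b} {b'} C same = T-injective (mk⇔ (transport b b' same) (transport b' b (sym ∘ same)))
  where
  transport : ∀ c c' → (∀ S → inSys (ss n V c) S ≡ inSys (ss n V c') S)
            → T (isoSS (ss n V c) C) → T (isoSS (ss n V c') C)
  transport c c' same′ t with to (T-isoSS (ss n V c) C) t
  ... | f , iso = from (T-isoSS (ss n V c') C) (f , record
    { bijOn      = IsoSS.bijOn iso
    ; inSys-pres = λ {S} S⊆V → trans (sym (same′ S)) (IsoSS.inSys-pres iso S⊆V)
    })

isoSS-graphicalBS : ∀ Γ Δ → isoSS (graphicalBS Γ) (graphicalBS Δ) ≡ isoGr Γ Δ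
isoSS-graphicalBS Γ Δ = T-injective (mk⇔
  (λ t → let (f , iso) = to (T-isoSS _ _) t in from (T-isoGr Γ Δ) (f , IsoSS⇒IsoGr iso))
  (λ t → let (f , iso) = to (T-isoGr Γ Δ) t in from (T-isoSS _ _) (f , IsoGr⇒IsoSS iso)))

-- Disjoint unions

split : ∀ n {m} (k : Fin (n + m)) → (∃ λ i → k ≡ i ↑ˡ m) ⊎ (∃ λ j → k ≡ n ↑ʳ j)
split n k with splitAt n k in eq
... | inj₁ i = inj₁ (i , sym (splitAt⁻¹-↑ˡ eq))
... | inj₂ j = inj₂ (j , sym (splitAt⁻¹-↑ʳ eq))

module _ {n m} (S₁ : Subset n) (S₂ : Subset m) where

  ∈-++ˡ : ∀ {i} → i ↑ˡ m ∈ S₁ ++ S₂ ⇔ i ∈ S₁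
  ∈-++ˡ {i} = mk⇔ (to T-mem ∘ subst T (lookup-++ˡ S₁ S₂ i) ∘ from T-mem)
                  (to T-mem ∘ subst T (sym (lookup-++ˡ S₁ S₂ i)) ∘ from T-mem)

  ∈-++ʳ : ∀ {j} → n ↑ʳ j ∈ S₁ ++ S₂ ⇔ j ∈ S₂
  ∈-++ʳ {j} = mk⇔ (to T-mem ∘ subst T (lookup-++ʳ S₁ S₂ j) ∘ from T-mem)
                  (to T-mem ∘ subst T (sym (lookup-++ʳ S₁ S₂ j)) ∘ from T-mem)

++∅⊆++ : ∀ {n m} (S₁ : Subset n) (S₂ : Subset m) → S₁ ++ ∅ ⊆ S₁ ++ S₂
++∅⊆++ {n} {m} S₁ S₂ {k} k∈ with split n {m} k
... | inj₁ (i , refl) = from (∈-++ˡ S₁ S₂) (to (∈-++ˡ S₁ ∅) k∈)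
... | inj₂ (j , refl) = ⊥-elim (∉⊥ (to (∈-++ʳ S₁ ∅) k∈))

T-emptyV : ∀ {n} {S : Subset n} → T (emptyV S) ⇔ Empty S
T-emptyV = mk⇔ (λ t ne → to T-not t (from T-nonempty ne)) (λ e → from T-not (e ∘ to T-nonempty))

module _ {n m} (V : Subset n) (a : Fin n → Fin n → Bool) (W : Subset m) (b : Fin m → Fin m → Bool) where
  private
    x = gr n V a
    y = gr m W b
    u = unionGr x y

  ==F-↑ˡ : ∀ (i i' : Fin n) → ((i ↑ˡ m) ==F (i' ↑ˡ m)) ≡ (i ==F i')
  ==F-↑ˡ i i' = does-⇔ (mk⇔ (↑ˡ-injective m i i') (cong (_↑ˡ m))) (i ↑ˡ m ≟ i' ↑ˡ m) (i ≟ i')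

  ==F-↑ʳ : ∀ (j j' : Fin m) → ((n ↑ʳ j) ==F (n ↑ʳ j')) ≡ (j ==F j')
  ==F-↑ʳ j j' = does-⇔ (mk⇔ (↑ʳ-injective n j j') (cong (n ↑ʳ_))) (n ↑ʳ j ≟ n ↑ʳ j') (j ≟ j')

  edge-↑ˡ : ∀ i i' → edge u (i ↑ˡ m) (i' ↑ˡ m) ≡ edge x i i'
  edge-↑ˡ i i' rewrite splitAt-↑ˡ n i m | splitAt-↑ˡ n i' m | ==F-↑ˡ i i' = refl

  edge-↑ʳ : ∀ j j' → edge u (n ↑ʳ j) (n ↑ʳ j') ≡ edge y j j'
  edge-↑ʳ j j' rewrite splitAt-↑ʳ n m j | splitAt-↑ʳ n m j' | ==F-↑ʳ j j' = refl

  edge-↑ˡ↑ʳ : ∀ i j → edge u (i ↑ˡ m) (n ↑ʳ j) ≡ false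
  edge-↑ˡ↑ʳ i j rewrite splitAt-↑ˡ n i m | splitAt-↑ʳ n m j = ∧-zeroʳ _

  inl : PMap n (n + m)
  inl = tabulate λ i → just (i ↑ˡ m)

  inr : PMap m (n + m)
  inr = tabulate λ j → just (n ↑ʳ j)

  inl-embedding : ∀ S → EmbeddingOn x u inl S
  inl-embedding S = record
    { defined   = λ {i} _ → i ↑ˡ m , lookup∘tabulate _ i
    ; injective = λ {i} {i'} _ _ eq →
        ↑ˡ-injective m i i'
          (just-injective (trans (sym (lookup∘tabulate _ i)) (trans eq (lookup∘tabulate _ i'))))
    ; edge-pres = λ {i} {i'} _ _ fi≡j fi'≡j' → trans
        (cong₂ (edge u) (just-injective (trans (sym fi≡j) (lookup∘tabulate _ i)))
                        (just-injective (trans (sym fi'≡j') (lookup∘tabulate _ i'))))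
        (edge-↑ˡ i i')
    }

  inr-embedding : ∀ S → EmbeddingOn y u inr S
  inr-embedding S = record
    { defined   = λ {j} _ → n ↑ʳ j , lookup∘tabulate _ j
    ; injective = λ {j} {j'} _ _ eq →
        ↑ʳ-injective n j j'
          (just-injective (trans (sym (lookup∘tabulate _ j)) (trans eq (lookup∘tabulate _ j'))))
    ; edge-pres = λ {j} {j'} _ _ fj≡k fj'≡k' → trans
        (cong₂ (edge u) (just-injective (trans (sym fj≡k) (lookup∘tabulate _ j)))
                        (just-injective (trans (sym fj'≡k') (lookup∘tabulate _ j'))))
        (edge-↑ʳ j j')
    }

  image-inl : ∀ S₁ → image inl S₁ ≡ S₁ ++ ∅
  image-inl S₁ = ⊆-antisym img⊆ ⊆img
    where
    img⊆ : image inl S₁ ⊆ S₁ ++ ∅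
    img⊆ k∈ with ∈-image⁻ inl {S₁} k∈
    ... | i , i∈S₁ , fi≡k rewrite just-injective (trans (sym fi≡k) (lookup∘tabulate _ i)) =
      from (∈-++ˡ S₁ ∅) i∈S₁
    ⊆img : S₁ ++ ∅ ⊆ image inl S₁
    ⊆img {k} k∈ with split n {m} k
    ... | inj₁ (i , refl) = ∈-image⁺ inl (to (∈-++ˡ S₁ ∅) k∈) (lookup∘tabulate _ i)
    ... | inj₂ (j , refl) = ⊥-elim (∉⊥ (to (∈-++ʳ S₁ ∅) k∈))

  image-inr : ∀ S₂ → image inr S₂ ≡ ∅ ++ S₂
  image-inr S₂ = ⊆-antisym img⊆ ⊆img
    where
    img⊆ : image inr S₂ ⊆ ∅ ++ S₂
    img⊆ k∈ with ∈-image⁻ inr {S₂} k∈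
    ... | j , j∈S₂ , fj≡k rewrite just-injective (trans (sym fj≡k) (lookup∘tabulate _ j)) =
      from (∈-++ʳ ∅ S₂) j∈S₂
    ⊆img : ∅ ++ S₂ ⊆ image inr S₂
    ⊆img {k} k∈ with split n {m} k
    ... | inj₁ (i , refl) = ⊥-elim (∉⊥ (to (∈-++ˡ ∅ S₂) k∈))
    ... | inj₂ (j , refl) = ∈-image⁺ inr (to (∈-++ʳ ∅ S₂) k∈) (lookup∘tabulate _ j)

  -- No edge of the union joins the two sides.
  union-disconnected : ∀ {S₁ S₂ i j} → Connected u (S₁ ++ S₂) → i ∈ S₁ → j ∈ S₂ → ⊥
  union-disconnected {S₁} {S₂} {i} {j} c i∈S₁ j∈S₂
    with Connected.crossing c (++∅⊆++ S₁ S₂) (i ↑ˡ m , from (∈-++ˡ S₁ ∅) i∈S₁)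
                              (λ ⊆A → ∉⊥ (to (∈-++ʳ S₁ ∅) (⊆A (from (∈-++ʳ S₁ S₂) j∈S₂))))
  ... | k , l , k∈A , l∈S , l∉A , e with split n {m} k | split n {m} l
  ...   | inj₂ (j′ , refl) | _ = ∉⊥ (to (∈-++ʳ S₁ ∅) k∈A)
  ...   | inj₁ _ | inj₁ (i′ , refl) = l∉A (from (∈-++ˡ S₁ ∅) (to (∈-++ˡ S₁ S₂) l∈S))
  ...   | inj₁ (i′ , refl) | inj₂ (j′ , refl) = subst T (edge-↑ˡ↑ʳ i′ j′) e

  connected-union : ∀ S₁ S₂
                  → Connected u (S₁ ++ S₂) ⇔ ((Empty S₂ × Connected x S₁) ⊎ (Empty S₁ × Connected y S₂))
  connected-union S₁ S₂ = mk⇔ fwd bwd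
    where
    fwd : Connected u (S₁ ++ S₂) → (Empty S₂ × Connected x S₁) ⊎ (Empty S₁ × Connected y S₂)
    fwd c with nonempty? S₁ | nonempty? S₂
    ... | yes (i , i∈S₁) | yes (j , j∈S₂) = ⊥-elim (union-disconnected c i∈S₁ j∈S₂)
    ... | _ | no ¬ne₂ = inj₁ (¬ne₂ , image-connected⁻ (inl-embedding S₁)
            (subst (Connected u) (trans (cong (S₁ ++_) (Empty-unique ¬ne₂)) (sym (image-inl S₁))) c))
    ... | no ¬ne₁ | _ = inj₂ (¬ne₁ , image-connected⁻ (inr-embedding S₂)
            (subst (Connected u) (trans (cong (_++ S₂) (Empty-unique ¬ne₁)) (sym (image-inr S₂))) c))
    bwd : (Empty S₂ × Connected x S₁) ⊎ (Empty S₁ × Connected y S₂) → Connected u (S₁ ++ S₂)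
    bwd (inj₁ (¬ne₂ , c)) =
      subst (Connected u) (trans (image-inl S₁) (cong (S₁ ++_) (sym (Empty-unique ¬ne₂))))
            (image-connected⁺ (inl-embedding S₁) c)
    bwd (inj₂ (¬ne₁ , c)) =
      subst (Connected u) (trans (image-inr S₂) (cong (_++ S₂) (sym (Empty-unique ¬ne₁))))
            (image-connected⁺ (inr-embedding S₂) c)

  connectedᵇ-unionGr : ∀ S₁ S₂ → connectedᵇ u (S₁ ++ S₂)
                     ≡ ((emptyV S₂ ∧ connectedᵇ x S₁) ∨ (emptyV S₁ ∧ connectedᵇ y S₂))
  connectedᵇ-unionGr S₁ S₂ = T-injective (mk⇔
    (from T-∨ ∘ Sum.map (from T-∧ ∘ Product.map (from T-emptyV) (from (T-connectedᵇ x S₁)))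
                        (from T-∧ ∘ Product.map (from T-emptyV) (from (T-connectedᵇ y S₂)))
              ∘ to (connected-union S₁ S₂) ∘ to (T-connectedᵇ u _))
    (from (T-connectedᵇ u _) ∘ from (connected-union S₁ S₂)
       ∘ Sum.map (Product.map (to T-emptyV) (to (T-connectedᵇ x S₁)) ∘ to T-∧)
                 (Product.map (to T-emptyV) (to (T-connectedᵇ y S₂)) ∘ to T-∧)
       ∘ to T-∨))

inSys-graphicalBS-unionGr : ∀ x y S → inSys (graphicalBS (unionGr x y)) S
                                    ≡ inSys (unionSS (graphicalBS x) (graphicalBS y)) S
inSys-graphicalBS-unionGr (gr n V a) (gr m W b) S =
  cong (λ c → nonempty S ∧ (S ⊆ᵇ (V ++ W)) ∧ c)
    (trans (cong (connectedᵇ (unionGr (gr n V a) (gr m W b))) (sym (take++drop≡id n S)))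
           (connectedᵇ-unionGr V a W b (take n S) (drop n S)))

isoSS-graphicalBS-unionGr : ∀ x y C → isoSS (graphicalBS (unionGr x y)) C
                                    ≡ isoSS (unionSS (graphicalBS x) (graphicalBS y)) C
isoSS-graphicalBS-unionGr (gr n V a) (gr m W b) C =
  isoSS-congˡ {V = V ++ W} C (inSys-graphicalBS-unionGr (gr n V a) (gr m W b))

module _ {c ℓ} (K : Field c ℓ) where
  open Lin K
  private
    module R = Field K

  module _ {X Y : Set} {eqY : Y → Y → Bool} where

    coeff-linMap : ∀ {eqX : X → X → Bool} (g : X → Y) {b b'} → (∀ x → eqY (g x) b' ≡ eqX x b)
                 → ∀ v → coeff eqY (linMap g v) b' ≡ coeff eqX v b
    coeff-linMap g same []            = refl
    coeff-linMap {eqX} g {b} {b'} same ((a , x) ∷ v) =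
      cong₂ (λ t r → (if t then a else R.0#) R.+ r) (same x) (coeff-linMap {eqX} g {b} {b'} same v)

    coeff-linMap-cong : ∀ (g h : X → Y) {b} → (∀ x → eqY (g x) b ≡ eqY (h x) b)
                      → ∀ v → coeff eqY (linMap g v) b ≡ coeff eqY (linMap h v) b
    coeff-linMap-cong g h same []            = refl
    coeff-linMap-cong g h {b} same ((a , x) ∷ v) =
      cong₂ (λ t r → (if t then a else R.0#) R.+ r) (same x) (coeff-linMap-cong g h {b} same v)

  coeff-unmatched : ∀ {X : Set} {eq : X → X → Bool} {b} v → All (λ (_ , x) → ¬ T (eq x b)) v
                  → coeff eq v b R.≈ R.0#
  coeff-unmatched []             []             = R.refl
  coeff-unmatched {eq = eq} {b} ((a , x) ∷ v) (¬match ∷ rest) rewrite to T-not-≡ (from T-not ¬match) =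
    R.trans (R.+-identityˡ _) (coeff-unmatched {eq = eq} {b} v rest)

  linFun-linMap : ∀ {X Y : Set} {f : Y → R.Carrier} {h : X → R.Carrier} (g : X → Y)
                → (∀ x → f (g x) ≡ h x) → ∀ v → linFun f (linMap g v) ≡ linFun h v
  linFun-linMap g same []            = refl
  linFun-linMap g same ((a , x) ∷ v) = cong₂ (λ s t → a R.* s R.+ t) (same x) (linFun-linMap g same v)

  tensor : ∀ {X Y : Set} → LC X → LC Y → LC (X × Y)
  tensor v w = concatMap (λ { (a , x) → map (λ { (b , y) → (a R.* b , (x , y)) }) w }) v

  module _ (Sp : Species) where
    open Species Sp using (Obj; _⊎ₒ_)
    open Str Sp using (mult)

    linMap-mult : ∀ {Y : Set} (g : Obj → Y) v w
                → linMap g (mult v w) ≡ linMap (λ (x , y) → g (x ⊎ₒ y)) (tensor v w)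
    linMap-mult g v w = trans (map-concatMap _ _ v)
      (trans (concatMap-cong (λ { (a , x) → map-∘-cong (λ { (b , y) → refl }) w }) v)
             (sym (map-concatMap _ _ v)))

    mult-linMap : ∀ {X : Set} (g : X → Obj) v w
                → mult (linMap g v) (linMap g w) ≡ linMap (λ (x , y) → g x ⊎ₒ g y) (tensor v w)
    mult-linMap g v w = trans (concatMap-map _ _ v)
      (trans (concatMap-cong (λ { (a , x) → map-∘-cong (λ { (b , y) → refl }) w }) v)
             (sym (map-concatMap _ _ v)))

-- The morphism β

module _ {c ℓ} (K : Field c ℓ) where
  open Lin K
  private
    module R = Field K
    module G = Str GraphSp
    module 𝔅 = Str SSysSp

    matches : ∀ C x → Dec (T (isoSS (graphicalBS x) C))
    matches C x = T? (isoSS (graphicalBS x) C)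

  coeff-graphicalBS : ∀ Γ C → (∀ x → isoSS (graphicalBS x) C ≡ isoGr x Γ)
                    → ∀ v → coeff isoSS (linMap graphicalBS v) C ≡ coeff isoGr v Γ
  coeff-graphicalBS Γ C = coeff-linMap K {eqY = isoSS} {isoGr} graphicalBS {Γ} {C}

  -- Once some graphical z is isomorphic to C, the coefficient of C counts the graphs isomorphic to z.
  coeff-through : ∀ v w → G.EqH v w → ∀ z C → T (isoSS (graphicalBS z) C)
                → coeff isoSS (linMap graphicalBS v) C R.≈ coeff isoSS (linMap graphicalBS w) C
  coeff-through v w v≈w z C z≅C =
    R.trans (R.reflexive (coeff-graphicalBS z C via-z v))
            (R.trans (v≈w z) (R.reflexive (sym (coeff-graphicalBS z C via-z w))))
    where
    via-z : ∀ x → isoSS (graphicalBS x) C ≡ isoGr x z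
    via-z x = T-injective (mk⇔
      (λ x≅C → subst T (isoSS-graphicalBS x z)
                 (isoSS-trans (graphicalBS x) C (graphicalBS z) x≅C (isoSS-sym (graphicalBS z) C z≅C)))
      (λ x≅z → isoSS-trans (graphicalBS x) (graphicalBS z) C (subst T (sym (isoSS-graphicalBS x z)) x≅z) z≅C))

  linMap-graphicalBS-cong : ∀ v w → G.EqH v w → 𝔅.EqH (linMap graphicalBS v) (linMap graphicalBS w)
  linMap-graphicalBS-cong v w v≈w C with Any.any? (matches C ∘ proj₂) v | Any.any? (matches C ∘ proj₂) w
  ... | yes m | _     = let ((_ , z) , z≅C) = Any.satisfied m in coeff-through v w v≈w z C z≅C
  ... | no _  | yes m = let ((_ , z) , z≅C) = Any.satisfied m in coeff-through v w v≈w z C z≅C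
  ... | no ¬v | no ¬w =
    R.trans (coeff-unmatched K {eq = isoSS} {C} (linMap graphicalBS v) (All.map⁺ (¬Any⇒All¬ v ¬v)))
            (R.sym (coeff-unmatched K {eq = isoSS} {C} (linMap graphicalBS w) (All.map⁺ (¬Any⇒All¬ w ¬w))))

  linMap-graphicalBS-proj : ∀ k v → linMap graphicalBS (G.proj k v) ≡ 𝔅.proj k (linMap graphicalBS v)
  linMap-graphicalBS-proj k [] = refl
  linMap-graphicalBS-proj k ((a , x) ∷ v) with Species.deg GraphSp x ==ℕ k
  ... | true  = cong ((a , graphicalBS x) ∷_) (linMap-graphicalBS-proj k v)
  ... | false = linMap-graphicalBS-proj k v

  graphicalBS-unit : 𝔅.EqH (linMap graphicalBS G.unitH) 𝔅.unitH
  graphicalBS-unit C =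
    R.reflexive (cong (λ t → (if t then R.1# else R.0#) R.+ R.0#)
                      (isoSS-congˡ {0} {[]} {connectedᵇ emptyGr} {λ _ → false} C λ { [] → refl }))

  graphicalBS-mult : ∀ v w → 𝔅.EqH (linMap graphicalBS (G.mult v w))
                                   (𝔅.mult (linMap graphicalBS v) (linMap graphicalBS w))
  graphicalBS-mult v w C = R.reflexive (begin
    coeff isoSS (linMap graphicalBS (G.mult v w)) C
      ≡⟨ cong (λ u → coeff isoSS u C) (linMap-mult K GraphSp graphicalBS v w) ⟩
    coeff isoSS (linMap (λ (x , y) → graphicalBS (unionGr x y)) (tensor K v w)) C
      ≡⟨ coeff-linMap-cong K {eqY = isoSS} _ _ {C} (λ (x , y) → isoSS-graphicalBS-unionGr x y C)
                           (tensor K v w) ⟩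
    coeff isoSS (linMap (λ (x , y) → unionSS (graphicalBS x) (graphicalBS y)) (tensor K v w)) C
      ≡⟨ cong (λ u → coeff isoSS u C) (mult-linMap K SSysSp graphicalBS v w) ⟨
    coeff isoSS (𝔅.mult (linMap graphicalBS v) (linMap graphicalBS w)) C ∎)

  -- restrSS (graphicalBS x) I is graphicalBS (restrGr x I) on the nose, since connectedᵇ
  -- ignores the vertex set.
  Δ-graphicalBS : ∀ v → 𝔅.Δ (linMap graphicalBS v)
                      ≡ linMap (λ (x , y) → (graphicalBS x , graphicalBS y)) (G.Δ v)
  Δ-graphicalBS v = trans (concatMap-map _ _ v)
    (trans (concatMap-cong (λ { (a , x) → trans (map-∘-cong (λ _ → refl) _) (cong (map _) (map-∘ _)) }) v)
           (sym (map-concatMap _ _ v)))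

  ζα-graphicalBS : ∀ x α → 𝔅.ζα (graphicalBS x) α ≡ G.ζα x α
  ζα-graphicalBS x α = cong length (filterᵇ-cong _ _ (λ g → cong₂ _∧_ refl (cong and (map-cong
    (λ t → cong₂ _∧_ refl (discreteᵇ-graphicalBS (restrGr x (tabulate λ i → lookup g i ==M just t))))
    (allFin (length α))))) (allPMaps (Gr.n x) (length α)))

  Ψ-graphicalBS : ∀ v → 𝔅.Ψ (linMap graphicalBS v) ≡ G.Ψ v
  Ψ-graphicalBS v = trans (concatMap-map _ _ v) (concatMap-cong (λ { (a , x) → cong (scale a)
    (map-cong (λ α → cong (λ k → (natK R.commutativeRing k , α)) (ζα-graphicalBS x α)) _) }) v)

  graphicalBS-isCHAMorphism : IsCHAMorphism GraphSp SSysSp graphicalBS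
  graphicalBS-isCHAMorphism = record
    { well-defined   = linMap-graphicalBS-cong
    ; graded         = λ k v C → R.reflexive (cong (λ u → coeff isoSS u C) (linMap-graphicalBS-proj k v))
    ; unit-pres      = graphicalBS-unit
    ; mult-pres      = graphicalBS-mult
    ; comult-pres    = λ v C → R.reflexive (cong (λ u → coeff (pairEq isoSS isoSS) u C) (Δ-graphicalBS v))
    ; counit-pres    = R.reflexive ∘ linFun-linMap K graphicalBS (λ _ → refl)
    ; character-pres = R.reflexive ∘ linFun-linMap K graphicalBS
                         (cong (λ t → if t then R.1# else R.0#) ∘ discreteᵇ-graphicalBS)
    }

  linMap-graphicalBS-injective : ∀ v w → 𝔅.EqH (linMap graphicalBS v) (linMap graphicalBS w) → G.EqH v w
  linMap-graphicalBS-injective v w βv≈βw Γ =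
    R.trans (R.reflexive (sym (coeff-graphicalBS Γ (graphicalBS Γ) (λ x → isoSS-graphicalBS x Γ) v)))
            (R.trans (βv≈βw (graphicalBS Γ))
                     (R.reflexive (coeff-graphicalBS Γ (graphicalBS Γ) (λ x → isoSS-graphicalBS x Γ) w)))

theorem1 : ∀ {c ℓ} (K : Field c ℓ) → let open Lin K in
    ((Γ : Gr) → IsBuildingSet (graphicalBS Γ))
    × IsCHAMorphism GraphSp SSysSp graphicalBS
    × (∀ v w → Str.EqH SSysSp (linMap graphicalBS v) (linMap graphicalBS w)
    → Str.EqH GraphSp v w)
    × (∀ v → EqQSym (Str.Ψ SSysSp (linMap graphicalBS v)) (Str.Ψ GraphSp v))
theorem1 K =
  graphicalBS-isBuildingSet ,
  graphicalBS-isCHAMorphism K ,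
  linMap-graphicalBS-injective K ,
  λ v α → Field.reflexive K (cong (λ u → Lin.coeff K _==L_ u α) (Ψ-graphicalBS K v))
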